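{- For all integers $n\ge 0$ and $k$ with $0\le k\le n+1$, the number of runs of the $(n,k)$-arch process satisfies $\sigma(A_{n,k})=t_{n,k}$, where the array $(t_{n,k})_{n\ge 0,k\ge 0}$ is defined by \[ t_{n,0}=1,\qquad t_{n,k}=\frac{n+2k-1}{2}\,t_{n,k-1}+\frac{n-k}{2}\,t_{n+1,k-1}\quad (k\ge 1). \]
   Context: A process is a finite set of actions together with a set of directed edges ("$u\to v$" means action $u$ must precede action $v$). A run of a process is a total ordering of all its actions such that for every edge $u\to v$, $u$ comes before $v$ (equivalently, an increasing labeling of the actions by $1,\dots,\ell$, $\ell$ the number of actions). $\sigma(A)$ denotes the number of runs of $A$. For integers $n\ge 0$ and $0\le k\le n+1$, the $(n,k)$-arch process $A_{n,k}$ is defined as follows. If $k\le n$: its actions are $a_1,\dots,a_k$, $x_1,\dots,x_{n-k}$, $c_1,\dots,c_k$, $b_1,\dots,b_k$; its edges form the trunk chain $a_1\to a_2\to\cdots\to a_k\to x_1\to\cdots\to x_{n-k}\to c_1\to c_2\to\cdots\to c_k$ (when $k=n$ there are no $x_i$ and $a_k\to c_1$; when $k=0$ the trunk is just $x_1\to\cdots\to x_n$), together with the edges $a_i\to b_i$ and $b_i\to c_i$ for each $i=1,\dots,k$. If $k=n+1$: the same construction with no actions $x_i$, except that $a_k$ and $c_1$ are one and the same action (so the trunk is $a_1\to\cdots\to a_{k-1}\to a_k=c_1\to c_2\to\cdots\to c_k$). In all cases $A_{n,k}$ has $n+2k$ actions. -}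

module Defs where

open import Level using (0ℓ)
open import Data.Nat using (ℕ; zero; suc; _+_; _*_; _<_)
open import Data.Fin using (Fin; toℕ)
import Data.Fin as Fin
open import Data.Integer using (ℤ; +_; _-_)
open import Data.Rational using (ℚ; _/_)
import Data.Rational as ℚ
open import Data.Product using (Σ; _×_; ∃-syntax; proj₁)
open import Data.Sum using (_⊎_)
open import Function.Definitions using (Bijective)
open import Function.Bundles using (Inverse)
open import Relation.Binary.Bundles using (Setoid)
open import Relation.Binary.PropositionalEquality using (_≡_; refl; sym; trans; setoid)

-- A process: a finite set of actions {0,…,size-1} (as Fin size) together
-- with a relation of directed edges  u ⇒ v  ("u must precede v").
record Process : Set₁ where
  field
    size : ℕ
    _⇒_  : Fin size → Fin size → Set
open Process public

-- A run: an increasing labeling of the actions by 1,…,ℓ, i.e. a bijection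
-- f : actions → Fin ℓ (labels shifted to 0,…,ℓ-1) with f u < f v on every edge.
IsRun : (A : Process) → (Fin (size A) → Fin (size A)) → Set
IsRun A f = Bijective _≡_ _≡_ f × (∀ u v → _⇒_ A u v → f u Fin.< f v)

Run : Process → Set
Run A = Σ (Fin (size A) → Fin (size A)) (IsRun A)

RunSetoid : Process → Setoid 0ℓ 0ℓ
RunSetoid A = record
  { Carrier = Run A
  ; _≈_ = λ r s → ∀ x → proj₁ r x ≡ proj₁ s x
  ; isEquivalence = record
    { refl = λ x → refl
    ; sym = λ p x → sym (p x)
    ; trans = λ p q x → trans (p x) (q x) } }

-- σ(A) = m : the runs of A are in bijection with an m-element set.
σ≡ : Process → ℕ → Set
σ≡ A m = Inverse (RunSetoid A) (setoid (Fin m))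

-- Actions are numbered 0,…,n+2k-1:
--   trunk positions 0,…,n+k-1 (chain p → p+1), with
--   a_i = i-1, x_j = k+j-1, c_i = n+i-1 (so a_k = c_1 when k = n+1),
--   b_i = n+k+i-1   (1 ≤ i ≤ k).
-- Extra edges: a_i → b_i and b_i → c_i.  (Written with 0-based i < k.)
archEdge : (n k : ℕ) → Fin (n + 2 * k) → Fin (n + 2 * k) → Set
archEdge n k u v =
    (toℕ v ≡ suc (toℕ u) × toℕ v < n + k)
  ⊎ (∃[ i ] (i < k × toℕ u ≡ i × toℕ v ≡ n + k + i))
  ⊎ (∃[ i ] (i < k × toℕ u ≡ n + k + i × toℕ v ≡ n + i))

Arch : ℕ → ℕ → Process
Arch n k = record { size = n + 2 * k ; _⇒_ = archEdge n k }

t : ℕ → ℕ → ℚ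
t n zero = ℚ.1ℚ
t n (suc k) =
  ((+ (n + 2 * k + 1)) / 2) ℚ.* t n k
  ℚ.+ ((+ n - + (suc k)) / 2) ℚ.* t (suc n) k

module Submission where

-- The arch process is a "pendant process": a trunk chain of L actions plus m
-- pendant actions, pendant j sitting in some gap of the trunk within a window
-- (lo_j , hi_j).  Consequences
-- for count: invariance under permuting pendants (via σ-pendant), under reversing
-- the trunk, and the factor contributed by a free pendant.  For the arch windows
-- these give  2·A(n,k+1) + A(n+1,k) = (n+2k+1)·A(n,k) + (n-k)·A(n+1,k)  (k ≤ n),
-- which over ℚ is the defining recurrence of t.
open import Defs
open import Data.Nat as ℕ using (ℕ; zero; suc; _+_; _*_; _∸_; _≤_; _<_; z≤n; s≤s; s≤s⁻¹; z<s; s<s)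
open import Data.Nat.Properties
open import Data.Fin as Fin using (Fin; zero; suc; toℕ; fromℕ<; cast; _↑ˡ_; _↑ʳ_; splitAt)
open import Data.Fin.Properties
  using (toℕ-injective; toℕ-fromℕ<; toℕ<n; toℕ-cast; cast-involutive; ¬Fin0; toℕ-↑ʳ; toℕ-↑ˡ; opposite-prop
        ; splitAt-↑ˡ; splitAt-↑ʳ; splitAt⁻¹-↑ˡ; splitAt⁻¹-↑ʳ)
open import Data.Nat.Tactic.RingSolver using (solve-∀)
import Data.Integer as ℤ
import Data.Integer.Properties as ℤ
open import Data.Integer.Tactic.RingSolver renaming (solve-∀ to ℤ-solve-∀)
open import Data.Rational as ℚ using (ℚ; _/_)
import Data.Rational.Properties as ℚ
import Data.Rational.Unnormalised as ℚᵘ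
import Data.Rational.Unnormalised.Properties as ℚᵘ
open import Data.Fin.Permutation using (↔⇒≡; transpose; reverse; lift₀; Permutation′; _⟨$⟩ʳ_; _⟨$⟩ˡ_; inverseʳ; inverseˡ)
open import Data.Product using (Σ; ∃-syntax; _×_; _,_; proj₁; proj₂)
open import Data.Sum using (_⊎_; inj₁; inj₂; [_,_]′)
open import Data.Empty using (⊥; ⊥-elim)
open import Relation.Nullary using (¬_; Dec; yes; no)
open import Relation.Binary.PropositionalEquality
open import Relation.Binary.Definitions using (Tri; tri<; tri≈; tri>)
open import Relation.Binary.Construct.Closure.Transitive using (TransClosure; [_]; _∷ʳ_)
  renaming (_∷_ to _then_)
open import Data.Vec.Functional using (Vector; _∷_; head; tail; map)
open import Function using (id; _∘_)
open import Function.Bundles using (Inverse)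
open import Function.Definitions using (Injective; Surjective)
import Function.Construct.Composition as Comp
import Function.Construct.Symmetry as Sym

path-mono : ∀ {N} {R : Fin N → Fin N → Set} (f : Fin N → Fin N) →
            (∀ u v → R u v → f u Fin.< f v) → ∀ {u v} → TransClosure R u v → f u Fin.< f v
path-mono f mono [ e ]      = mono _ _ e
path-mono f mono (e then path) = <-trans (mono _ _ e) (path-mono f mono path)

module _ (P Q : Process) (e : size P ≡ size Q)
         (π : Fin (size P) → Fin (size Q)) (π' : Fin (size Q) → Fin (size P))
         (ππ' : ∀ y → π (π' y) ≡ y) (π'π : ∀ x → π' (π x) ≡ x)
         (Q⇒P : ∀ u v → _⇒_ Q u v → TransClosure (_⇒_ P) (π' u) (π' v)) where

  pullRun : Run P → Run Q
  pullRun (f , (f-inj , f-surj) , f-mono) = g , (g-inj , g-surj) , g-mono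
    where
    g : Fin (size Q) → Fin (size Q)
    g y = cast e (f (π' y))
    cast-inj : ∀ {a b} → cast e a ≡ cast e b → a ≡ b
    cast-inj {a} {b} h = toℕ-injective (trans (sym (toℕ-cast e a)) (trans (cong toℕ h) (toℕ-cast e b)))
    g-inj : Injective _≡_ _≡_ g
    g-inj {x} {y} h = trans (sym (ππ' x)) (trans (cong π (f-inj (cast-inj h))) (ππ' y))
    g-surj : Surjective _≡_ _≡_ g
    g-surj y = π x , λ {z} z≡πx → trans (cong g z≡πx) gπx≡y
      where
      x : Fin (size P)
      x = proj₁ (f-surj (cast (sym e) y))
      gπx≡y : g (π x) ≡ y
      gπx≡y = trans (cong (λ w → cast e (f w)) (π'π x))
                (trans (cong (cast e) (proj₂ (f-surj (cast (sym e) y)) refl)) (cast-involutive e (sym e) y))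
    g-mono : ∀ u v → _⇒_ Q u v → g u Fin.< g v
    g-mono u v h = subst₂ _<_ (sym (toℕ-cast e _)) (sym (toℕ-cast e _)) (path-mono f f-mono (Q⇒P u v h))

relabel : ∀ (P Q : Process) (e : size P ≡ size Q)
  (π : Fin (size P) → Fin (size Q)) (π' : Fin (size Q) → Fin (size P))
  → (∀ y → π (π' y) ≡ y) → (∀ x → π' (π x) ≡ x)
  → (∀ u v → _⇒_ P u v → TransClosure (_⇒_ Q) (π u) (π v))
  → (∀ u v → _⇒_ Q u v → TransClosure (_⇒_ P) (π' u) (π' v))
  → Inverse (RunSetoid P) (RunSetoid Q)
relabel P Q e π π' ππ' π'π P⇒Q Q⇒P = record
  { to        = pullRun P Q e π π' ππ' π'π Q⇒P
  ; from      = pullRun Q P (sym e) π' π π'π ππ' P⇒Q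
  ; to-cong   = λ h y → cong (cast e) (h (π' y))
  ; from-cong = λ h x → cong (cast (sym e)) (h (π x))
  ; inverse   = (λ {r} h y → trans (cong (cast e) (h (π' y)))
                               (trans (cast-involutive e (sym e) _) (cong (proj₁ r) (ππ' y))))
              , (λ {r} h x → trans (cong (cast (sym e)) (h (π x)))
                               (trans (cast-involutive (sym e) e _) (cong (proj₁ r) (π'π x))))
  }

σ-along : ∀ {P Q m} → Inverse (RunSetoid P) (RunSetoid Q) → σ≡ Q m → σ≡ P m
σ-along = Comp.inverse

σ-unique : ∀ {P a b} → σ≡ P a → σ≡ P b → a ≡ b
σ-unique I J = ↔⇒≡ (Comp.inverse (Sym.inverse I) J)

σ-empty : ∀ {P} → ¬ Run P → σ≡ P 0
σ-empty {P} noRun = record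
  { to        = λ r → ⊥-elim (noRun r)
  ; from      = λ i → ⊥-elim (¬Fin0 i)
  ; to-cong   = λ {r} _ → ⊥-elim (noRun r)
  ; from-cong = λ {i} _ → ⊥-elim (¬Fin0 i)
  ; inverse   = (λ {i} _ → ⊥-elim (¬Fin0 i)) , (λ {r} _ → ⊥-elim (noRun r))
  }

σ-single : ∀ {P} (r₀ : Run P) → (∀ (r : Run P) x → proj₁ r x ≡ proj₁ r₀ x) → σ≡ P 1
σ-single {P} r₀ unique = record
  { to        = λ _ → zero
  ; from      = λ _ → r₀
  ; to-cong   = λ _ → refl
  ; from-cong = λ _ x → refl
  ; inverse   = (λ { {zero} _ → refl }) , (λ {r} _ x → sym (unique r x))
  }

addEdge : (P : Process) → Fin (size P) → Fin (size P) → Process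
addEdge P u v = record { size = size P ; _⇒_ = λ x y → _⇒_ P x y ⊎ (x ≡ u × y ≡ v) }

-- Case split on the relative order of two distinct actions u, v: every run of P
-- runs either P + (u → v) or P + (v → u), but not both, so the counts add up.
module OrderSplit (P : Process) (u v : Fin (size P)) (u≢v : u ≢ v) {a b : ℕ}
  (I₁ : σ≡ (addEdge P u v) a) (I₂ : σ≡ (addEdge P v u) b) where

  module I₁ = Inverse I₁
  module I₂ = Inverse I₂

  extend : ∀ {x y} → (r : Run P) → proj₁ r x Fin.< proj₁ r y → Run (addEdge P x y)
  extend (f , bij , mono) lt = f , bij , λ { p q (inj₁ e) → mono p q e ; p q (inj₂ (refl , refl)) → lt }

  forget : ∀ {x y} → Run (addEdge P x y) → Run P
  forget (f , bij , mono) = f , bij , λ p q e → mono p q (inj₁ e)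

  flip : (r : Run P) → ¬ (proj₁ r u Fin.< proj₁ r v) → proj₁ r v Fin.< proj₁ r u
  flip (f , (inj , _) , _) h = ≤∧≢⇒< (≮⇒≥ h) (λ e → u≢v (inj (toℕ-injective (sym e))))

  encode : (r : Run P) → Dec (proj₁ r u Fin.< proj₁ r v) → Fin (a + b)
  encode r (yes lt) = I₁.to (extend r lt) ↑ˡ b
  encode r (no nlt) = a ↑ʳ I₂.to (extend r (flip r nlt))

  to : Run P → Fin (a + b)
  to r = encode r (proj₁ r u Fin.<? proj₁ r v)

  from : Fin (a + b) → Run P
  from i = [ (λ j → forget (I₁.from j)) , (λ j → forget (I₂.from j)) ]′ (splitAt a i)

  from₁-ordered : ∀ j → proj₁ (I₁.from j) u Fin.< proj₁ (I₁.from j) v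
  from₁-ordered j = proj₂ (proj₂ (I₁.from j)) u v (inj₂ (refl , refl))

  from₂-ordered : ∀ j → proj₁ (I₂.from j) v Fin.< proj₁ (I₂.from j) u
  from₂-ordered j = proj₂ (proj₂ (I₂.from j)) v u (inj₂ (refl , refl))

  to-cong : ∀ {r s : Run P} → (∀ x → proj₁ r x ≡ proj₁ s x) → to r ≡ to s
  to-cong {r} {s} h with proj₁ r u Fin.<? proj₁ r v | proj₁ s u Fin.<? proj₁ s v
  ... | yes p | yes q = cong (_↑ˡ b) (I₁.to-cong h)
  ... | no p  | no q  = cong (a ↑ʳ_) (I₂.to-cong h)
  ... | yes p | no q  = ⊥-elim (q (subst₂ Fin._<_ (h u) (h v) p))
  ... | no p  | yes q = ⊥-elim (p (subst₂ Fin._<_ (sym (h u)) (sym (h v)) q))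

  to-from : ∀ {i : Fin (a + b)} {r : Run P} → (∀ x → proj₁ r x ≡ proj₁ (from i) x) → to r ≡ i
  to-from {i} {r} h with splitAt a i in eq
  ... | inj₁ j with proj₁ r u Fin.<? proj₁ r v
  ...   | yes lt  = trans (cong (_↑ˡ b) (I₁.inverseˡ h)) (splitAt⁻¹-↑ˡ eq)
  ...   | no nlt  = ⊥-elim (nlt (subst₂ Fin._<_ (sym (h u)) (sym (h v)) (from₁-ordered j)))
  to-from {i} {r} h | inj₂ j with proj₁ r u Fin.<? proj₁ r v
  ...   | yes lt  = ⊥-elim (<-asym lt (subst₂ Fin._<_ (sym (h v)) (sym (h u)) (from₂-ordered j)))
  ...   | no nlt  = trans (cong (a ↑ʳ_) (I₂.inverseˡ h)) (splitAt⁻¹-↑ʳ eq)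

  from-to : ∀ {r : Run P} {i : Fin (a + b)} → i ≡ to r → ∀ x → proj₁ (from i) x ≡ proj₁ r x
  from-to {r} refl with proj₁ r u Fin.<? proj₁ r v
  ... | yes lt rewrite splitAt-↑ˡ a (I₁.to (extend r lt)) b = I₁.inverseʳ refl
  ... | no nlt rewrite splitAt-↑ʳ a b (I₂.to (extend r (flip r nlt))) = I₂.inverseʳ refl

  σ-sum : σ≡ P (a + b)
  σ-sum = record
    { to        = to
    ; from      = from
    ; to-cong   = to-cong
    ; from-cong = λ { refl x → refl }
    ; inverse   = (λ {i} {r} h → to-from {i} {r} h) , (λ {r} {i} h → from-to {r} {i} h)
    }

σ-split : ∀ (P : Process) (u v : Fin (size P)) → u ≢ v → ∀ {a b} →
          σ≡ (addEdge P u v) a → σ≡ (addEdge P v u) b → σ≡ P (a + b)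
σ-split P u v u≢v I₁ I₂ = OrderSplit.σ-sum P u v u≢v I₁ I₂

TrunkStep : ∀ {N} → ℕ → Fin N → Fin N → Set
TrunkStep L u v = toℕ v ≡ suc (toℕ u) × toℕ v < L

trunk-path : ∀ {N L} {R : Fin N → Fin N → Set} → (∀ {u v} → TrunkStep L u v → R u v) →
             ∀ (x y : Fin N) → toℕ x < toℕ y → toℕ y < L → TransClosure R x y
trunk-path {N} {L} {R} step x y x<y y<L = go (toℕ y) y refl x<y y<L
  where
  go : ∀ k (y : Fin N) → toℕ y ≡ k → toℕ x < k → k < L → TransClosure R x y
  go (suc k) y y≡ x<k k<L with toℕ x ℕ.≟ k
  ... | yes x≡k = [ step (trans y≡ (cong suc (sym x≡k)) , subst (_< L) (sym y≡) k<L) ]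
  ... | no x≢k  = go k z (toℕ-fromℕ< z<N) (≤∧≢⇒< (s≤s⁻¹ x<k) x≢k) (<-trans (n<1+n k) k<L)
                  ∷ʳ step (trans y≡ (cong suc (sym (toℕ-fromℕ< z<N))) , subst (_< L) (sym y≡) k<L)
    where
    z<N : k < N
    z<N = <-trans (n<1+n k) (subst (_< N) y≡ (toℕ<n y))
    z : Fin N
    z = fromℕ< z<N

-- A labelling of Fin N increasing along every successor step is the identity:
-- it cannot fall below the identity (counting up from 0) nor exceed it
-- (counting down from N - 1).
chain-identity : ∀ {N} (f : Fin N → Fin N) →
                 (∀ x y → toℕ y ≡ suc (toℕ x) → f x Fin.< f y) → ∀ x → f x ≡ x
chain-identity {N} f mono x = toℕ-injective (≤-antisym (≤-pred upper) (above (toℕ x) x refl))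
  where
  successor : ∀ k → suc k < N → Σ (Fin N) λ y → toℕ y ≡ suc k
  successor k h = fromℕ< h , toℕ-fromℕ< h
  predecessor : ∀ k → suc k < N → Σ (Fin N) λ y → toℕ y ≡ k
  predecessor k h = fromℕ< (<-trans (n<1+n k) h) , toℕ-fromℕ< _
  above : ∀ k (x : Fin N) → toℕ x ≡ k → k ≤ toℕ (f x)
  above zero    x _  = z≤n
  above (suc k) x x≡ with predecessor k (subst (_< N) x≡ (toℕ<n x))
  ... | (y , y≡) = ≤-<-trans (above k y y≡) (mono y x (trans x≡ (cong suc (sym y≡))))
  below : ∀ d (x : Fin N) → toℕ x + d < N → toℕ (f x) + d < N
  below zero    x _ = subst (_< N) (sym (+-identityʳ _)) (toℕ<n (f x))
  below (suc d) x h with successor (toℕ x) (≤-<-trans (m≤m+n _ d) (subst (_< N) (+-suc (toℕ x) d) h))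
  ... | (y , y≡) = subst (_< N) (sym (+-suc (toℕ (f x)) d))
                     (≤-<-trans (+-monoˡ-< d (mono x y y≡))
                                (below d y (subst (λ t → t + d < N) (sym y≡)
                                                  (subst (_< N) (+-suc (toℕ x) d) h))))
  upper : toℕ (f x) < suc (toℕ x)
  upper = +-cancelʳ-< d (toℕ (f x)) (suc (toℕ x))
            (subst (toℕ (f x) + d <_) (sym x+1+d≡N) (below d x (subst (toℕ x + d <_) x+1+d≡N (n<1+n _))))
    where
    d : ℕ
    d = N ∸ suc (toℕ x)
    x+1+d≡N : suc (toℕ x) + d ≡ N
    x+1+d≡N = m+[n∸m]≡n (toℕ<n x)

-- A window (lo , hi) lets a pendant action sit in any gap g of the trunk with
-- lo ≤ g ≤ hi; gap g is the place between trunk actions g - 1 and g.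
Window : Set
Window = ℕ × ℕ

Valid : ℕ → ∀ {m} → Vector Window m → Set
Valid L W = ∀ j → proj₁ (W j) ≤ L × proj₂ (W j) ≤ L

-- The pendant process: a trunk chain on the actions 0, …, L - 1, and pendant
-- actions L + j (j < m), each preceded by the trunk action lo_j - 1 (if lo_j > 0)
-- and followed by the trunk action hi_j (if hi_j < L).
PendantEdge : (L m : ℕ) → Vector Window m → Fin (L + m) → Fin (L + m) → Set
PendantEdge L m W u v =
    TrunkStep L u v
  ⊎ (Σ (Fin m) λ j → toℕ v ≡ L + toℕ j × suc (toℕ u) ≡ proj₁ (W j))
  ⊎ (Σ (Fin m) λ j → toℕ u ≡ L + toℕ j × toℕ v ≡ proj₂ (W j) × proj₂ (W j) < L)

Pendant : (L m : ℕ) → Vector Window m → Process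
Pendant L m W = record { size = L + m ; _⇒_ = PendantEdge L m W }

-- Turning a pendant placed in gap p into a new trunk action at position p shifts
-- every trunk position ≥ p up by one; a window moves accordingly.
shiftLo : ℕ → ℕ → ℕ
shiftLo p lo with lo ≤? p
... | yes _ = lo
... | no _  = suc lo

shiftHi : ℕ → ℕ → ℕ
shiftHi p hi with p ≤? hi
... | yes _ = suc hi
... | no _  = hi

shiftWindow : ℕ → Window → Window
shiftWindow p (lo , hi) = shiftLo p lo , shiftHi p hi

shiftLo-≤ : ∀ {p lo} → lo ≤ p → shiftLo p lo ≡ lo
shiftLo-≤ {p} {lo} h with lo ≤? p
... | yes _ = refl
... | no ¬h = ⊥-elim (¬h h)

shiftLo-> : ∀ {p lo} → p < lo → shiftLo p lo ≡ suc lo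
shiftLo-> {p} {lo} h with lo ≤? p
... | yes h' = ⊥-elim (<⇒≱ h h')
... | no _   = refl

shiftHi-≥ : ∀ {p hi} → p ≤ hi → shiftHi p hi ≡ suc hi
shiftHi-≥ {p} {hi} h with p ≤? hi
... | yes _ = refl
... | no ¬h = ⊥-elim (¬h h)

shiftHi-< : ∀ {p hi} → hi < p → shiftHi p hi ≡ hi
shiftHi-< {p} {hi} h with p ≤? hi
... | yes h' = ⊥-elim (<⇒≱ h h')
... | no _   = refl

shiftLo-≤-suc : ∀ p lo → shiftLo p lo ≤ suc lo
shiftLo-≤-suc p lo with lo ≤? p
... | yes _ = n≤1+n lo
... | no _  = ≤-refl

shiftHi-≤-suc : ∀ p hi → shiftHi p hi ≤ suc hi
shiftHi-≤-suc p hi with p ≤? hi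
... | yes _ = ≤-refl
... | no _  = n≤1+n hi

placeAt : ∀ {m} → ℕ → Vector Window (suc m) → Vector Window m
placeAt p W j = shiftWindow p (W (suc j))

placeAt-valid : ∀ {m} L (W : Vector Window (suc m)) p → Valid L W → Valid (suc L) (placeAt p W)
placeAt-valid L W p valid j =
  ≤-trans (shiftLo-≤-suc p _) (s≤s (proj₁ (valid (suc j)))) ,
  ≤-trans (shiftHi-≤-suc p _) (s≤s (proj₂ (valid (suc j))))

sumFrom : ℕ → ℕ → (ℕ → ℕ) → ℕ
sumFrom a zero    f = 0
sumFrom a (suc m) f = f a + sumFrom (suc a) m f

-- The count: place the first pendant in each admissible gap p in turn, make it a
-- trunk action, and count the remaining pendants recursively.
count : (m : ℕ) → Vector Window m → ℕ
count zero    W = 1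
count (suc m) W = sumFrom (proj₁ (W zero)) (suc (proj₂ (W zero)) ∸ proj₁ (W zero))
                          (λ p → count m (placeAt p W))

trunkAt : ∀ {L m} i → i < L → Fin (L + m)
trunkAt {L} {m} i i<L = fromℕ< (<-≤-trans i<L (m≤m+n L m))

toℕ-trunkAt : ∀ {L m} i (i<L : i < L) → toℕ (trunkAt {L} {m} i i<L) ≡ i
toℕ-trunkAt i i<L = toℕ-fromℕ< _

pendantAt : ∀ {L m} → Fin m → Fin (L + m)
pendantAt {L} j = L ↑ʳ j

toℕ-pendantAt : ∀ {L m} (j : Fin m) → toℕ (pendantAt {L} {m} j) ≡ L + toℕ j
toℕ-pendantAt {L} j = toℕ-↑ʳ L j

σ-trunk : ∀ L (W : Vector Window 0) → σ≡ (Pendant L 0 W) 1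
σ-trunk L W = σ-single identityRun
  (λ r → chain-identity (proj₁ r) (λ u v v≡ → proj₂ (proj₂ r) u v (inj₁ (v≡ , below-L v))))
  where
  below-L : ∀ (v : Fin (L + 0)) → toℕ v < L
  below-L v = subst (toℕ v <_) (+-identityʳ L) (toℕ<n v)
  identityRun : Run (Pendant L 0 W)
  identityRun = id , (id , (λ y → y , id)) , increasing
    where
    increasing : ∀ u v → PendantEdge L 0 W u v → u Fin.< v
    increasing u v (inj₁ (v≡ , _)) = subst (toℕ u <_) (sym v≡) (n<1+n (toℕ u))
    increasing u v (inj₂ (inj₁ (() , _)))
    increasing u v (inj₂ (inj₂ (() , _)))

-- A pendant whose window is empty (hi < lo) admits no run: it must follow the
-- trunk action lo - 1 and precede the trunk action hi, which does not come later.
σ-emptyWindow : ∀ L m (W : Vector Window (suc m)) → Valid L W →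
                proj₂ (W zero) < proj₁ (W zero) → σ≡ (Pendant L (suc m) W) 0
σ-emptyWindow L m W valid hi<lo with proj₁ (W zero) in lo≡
... | suc l = σ-empty λ { (f , _ , mono) → impossible f mono }
  where
  hi : ℕ
  hi = proj₂ (W zero)
  l<L : l < L
  l<L = subst (_≤ L) lo≡ (proj₁ (valid zero))
  hi<L : hi < L
  hi<L = <-≤-trans hi<lo l<L
  b x y : Fin (L + suc m)
  b = pendantAt zero
  x = trunkAt l l<L
  y = trunkAt hi hi<L
  impossible : (f : Fin (L + suc m) → Fin (L + suc m)) →
               (∀ u v → PendantEdge L (suc m) W u v → f u Fin.< f v) → ⊥
  impossible f mono = <-irrefl refl (<-≤-trans (<-trans x<b b<y) y≤x)
    where
    x<b : f x Fin.< f b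
    x<b = mono x b (inj₂ (inj₁ (zero , toℕ-pendantAt zero , trans (cong suc (toℕ-trunkAt l l<L)) (sym lo≡))))
    b<y : f b Fin.< f y
    b<y = mono b y (inj₂ (inj₂ (zero , toℕ-pendantAt zero , toℕ-trunkAt hi hi<L , hi<L)))
    y≤x : toℕ (f y) ≤ toℕ (f x)
    y≤x with <-cmp hi l
    ... | tri< hi<l _ _ = <⇒≤ (path-mono f mono (trunk-path inj₁ y x
                             (subst₂ _<_ (sym (toℕ-trunkAt hi hi<L)) (sym (toℕ-trunkAt l l<L)) hi<l)
                             (subst (_< L) (sym (toℕ-trunkAt l l<L)) l<L)))
    ... | tri≈ _ hi≡l _ = ≤-reflexive (cong (λ z → toℕ (f z)) (toℕ-injective
                             (trans (toℕ-trunkAt hi hi<L) (trans hi≡l (sym (toℕ-trunkAt l l<L))))))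
    ... | tri> _ _ l<hi = ⊥-elim (<⇒≱ hi<lo l<hi)

module FinBijection {N₁ N₂ : ℕ} (f g : ℕ → ℕ)
  (f-bound : ∀ x → x < N₁ → f x < N₂) (g-bound : ∀ y → y < N₂ → g y < N₁)
  (g∘f : ∀ x → g (f x) ≡ x) (f∘g : ∀ y → f (g y) ≡ y) where

  to : Fin N₁ → Fin N₂
  to x = fromℕ< (f-bound (toℕ x) (toℕ<n x))

  from : Fin N₂ → Fin N₁
  from y = fromℕ< (g-bound (toℕ y) (toℕ<n y))

  toℕ-to : ∀ x → toℕ (to x) ≡ f (toℕ x)
  toℕ-to x = toℕ-fromℕ< _

  toℕ-from : ∀ y → toℕ (from y) ≡ g (toℕ y)
  toℕ-from y = toℕ-fromℕ< _

  to-from : ∀ y → to (from y) ≡ y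
  to-from y = toℕ-injective (trans (toℕ-to (from y)) (trans (cong f (toℕ-from y)) (f∘g (toℕ y))))

  from-to : ∀ x → from (to x) ≡ x
  from-to x = toℕ-injective (trans (toℕ-from (to x)) (trans (cong g (toℕ-to x)) (g∘f (toℕ x))))

-- If the first pendant's window is the single gap p, that pendant is
-- in effect a trunk action at position p.  Old labels (trunk of length L, pendant
-- 0 at label L) are mapped to new labels (trunk of length L + 1) by
--   x ↦ x (x < p),  x ↦ x + 1 (p ≤ x < L),  L ↦ p,  x ↦ x (pendants, x > L).
module Absorption (L m p : ℕ) (p≤L : p ≤ L) (W : Vector Window (suc m)) (valid : Valid L W)
                  (lo≡p : proj₁ (W zero) ≡ p) (hi≡p : proj₂ (W zero) ≡ p) where

  data OldLabel (x : ℕ) : Set where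
    before  : x < p → OldLabel x
    after   : p ≤ x → x < L → OldLabel x
    placed  : x ≡ L → OldLabel x
    pendant : L < x → OldLabel x

  oldLabel : ∀ x → OldLabel x
  oldLabel x with x <? p | x <? L | x ℕ.≟ L
  ... | yes x<p | _       | _       = before x<p
  ... | no x≮p  | yes x<L | _       = after (≮⇒≥ x≮p) x<L
  ... | no _    | no _    | yes x≡L = placed x≡L
  ... | no _    | no x≮L  | no x≢L  = pendant (≤∧≢⇒< (≮⇒≥ x≮L) (x≢L ∘ sym))

  data NewLabel (y : ℕ) : Set where
    before  : y < p → NewLabel y
    placed  : y ≡ p → NewLabel y
    after   : p < y → y ≤ L → NewLabel y
    pendant : L < y → NewLabel y

  newLabel : ∀ y → NewLabel y
  newLabel y with y <? p | y ℕ.≟ p | y ≤? L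
  ... | yes y<p | _       | _       = before y<p
  ... | no _    | yes y≡p | _       = placed y≡p
  ... | no y≮p  | no y≢p  | yes y≤L = after (≤∧≢⇒< (≮⇒≥ y≮p) (y≢p ∘ sym)) y≤L
  ... | no _    | no _    | no y≰L  = pendant (≰⇒> y≰L)

  absorbℕ : ℕ → ℕ
  absorbℕ x with oldLabel x
  ... | before _  = x
  ... | after _ _ = suc x
  ... | placed _  = p
  ... | pendant _ = x

  releaseℕ : ℕ → ℕ
  releaseℕ y with newLabel y
  ... | before _  = y
  ... | placed _  = L
  ... | after _ _ = ℕ.pred y
  ... | pendant _ = y

  absorb-before : ∀ {x} → x < p → absorbℕ x ≡ x
  absorb-before {x} x<p with oldLabel x
  ... | before _      = refl
  ... | after p≤x _   = ⊥-elim (<⇒≱ x<p p≤x)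
  ... | placed refl   = ⊥-elim (<⇒≱ x<p p≤L)
  ... | pendant L<x   = ⊥-elim (<⇒≱ x<p (≤-trans p≤L (<⇒≤ L<x)))

  absorb-after : ∀ {x} → p ≤ x → x < L → absorbℕ x ≡ suc x
  absorb-after {x} p≤x x<L with oldLabel x
  ... | before x<p    = ⊥-elim (<⇒≱ x<p p≤x)
  ... | after _ _     = refl
  ... | placed refl   = ⊥-elim (<-irrefl refl x<L)
  ... | pendant L<x   = ⊥-elim (<-asym L<x x<L)

  absorb-placed : absorbℕ L ≡ p
  absorb-placed with oldLabel L
  ... | before L<p    = ⊥-elim (<⇒≱ L<p p≤L)
  ... | after _ L<L   = ⊥-elim (<-irrefl refl L<L)
  ... | placed _      = refl
  ... | pendant L<L   = ⊥-elim (<-irrefl refl L<L)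

  absorb-pendant : ∀ {x} → L < x → absorbℕ x ≡ x
  absorb-pendant {x} L<x with oldLabel x
  ... | before x<p    = ⊥-elim (<⇒≱ x<p (≤-trans p≤L (<⇒≤ L<x)))
  ... | after _ x<L   = ⊥-elim (<-asym x<L L<x)
  ... | placed refl   = ⊥-elim (<-irrefl refl L<x)
  ... | pendant _     = refl

  release-before : ∀ {y} → y < p → releaseℕ y ≡ y
  release-before {y} y<p with newLabel y
  ... | before _      = refl
  ... | placed refl   = ⊥-elim (<-irrefl refl y<p)
  ... | after p<y _   = ⊥-elim (<-asym p<y y<p)
  ... | pendant L<y   = ⊥-elim (<-asym y<p (≤-<-trans p≤L L<y))

  release-placed : releaseℕ p ≡ L
  release-placed with newLabel p
  ... | before p<p    = ⊥-elim (<-irrefl refl p<p)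
  ... | placed _      = refl
  ... | after p<p _   = ⊥-elim (<-irrefl refl p<p)
  ... | pendant L<p   = ⊥-elim (<⇒≱ L<p p≤L)

  release-after : ∀ {y} → p < y → y ≤ L → releaseℕ y ≡ ℕ.pred y
  release-after {y} p<y y≤L with newLabel y
  ... | before y<p    = ⊥-elim (<-asym y<p p<y)
  ... | placed refl   = ⊥-elim (<-irrefl refl p<y)
  ... | after _ _     = refl
  ... | pendant L<y   = ⊥-elim (<⇒≱ L<y y≤L)

  release-pendant : ∀ {y} → L < y → releaseℕ y ≡ y
  release-pendant {y} L<y with newLabel y
  ... | before y<p    = ⊥-elim (<-asym y<p (≤-<-trans p≤L L<y))
  ... | placed refl   = ⊥-elim (<⇒≱ L<y p≤L)
  ... | after _ y≤L   = ⊥-elim (<⇒≱ L<y y≤L)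
  ... | pendant _     = refl

  releaseℕ∘absorbℕ : ∀ x → releaseℕ (absorbℕ x) ≡ x
  releaseℕ∘absorbℕ x with oldLabel x
  ... | before x<p      = release-before x<p
  ... | after p≤x x<L   = release-after (s≤s p≤x) x<L
  ... | placed refl     = release-placed
  ... | pendant L<x     = release-pendant L<x

  absorbℕ∘releaseℕ : ∀ y → absorbℕ (releaseℕ y) ≡ y
  absorbℕ∘releaseℕ y with newLabel y
  ... | before y<p              = absorb-before y<p
  ... | placed refl             = absorb-placed
  ... | after p<y y≤L           = absorb-pred p<y y≤L
    where
    absorb-pred : ∀ {y} → p < y → y ≤ L → absorbℕ (ℕ.pred y) ≡ y
    absorb-pred {suc y} p<y y≤L = absorb-after (s≤s⁻¹ p<y) y≤L
  ... | pendant L<y             = absorb-pendant L<y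

  absorb-bound : ∀ x → x < L + suc m → absorbℕ x < suc L + m
  absorb-bound x x<N with oldLabel x
  ... | before _      = subst (x <_) (+-suc L m) x<N
  ... | after _ x<L   = s≤s (≤-trans x<L (m≤m+n L m))
  ... | placed _      = s≤s (≤-trans p≤L (m≤m+n L m))
  ... | pendant _     = subst (x <_) (+-suc L m) x<N

  release-bound : ∀ y → y < suc L + m → releaseℕ y < L + suc m
  release-bound y y<N with newLabel y
  ... | before _      = subst (y <_) (sym (+-suc L m)) y<N
  ... | placed _      = subst (L <_) (sym (+-suc L m)) (s≤s (m≤m+n L m))
  ... | after _ y≤L   = ≤-<-trans (≤-trans (pred[n]≤n {y}) y≤L) (subst (L <_) (sym (+-suc L m)) (s≤s (m≤m+n L m)))
  ... | pendant _     = subst (y <_) (sym (+-suc L m)) y<N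

  open FinBijection {L + suc m} {suc L + m} absorbℕ releaseℕ absorb-bound release-bound
                    releaseℕ∘absorbℕ absorbℕ∘releaseℕ
    renaming (to to absorb; from to release; toℕ-to to toℕ-absorb; toℕ-from to toℕ-release
             ; to-from to absorb∘release; from-to to release∘absorb)

  absorb-shiftLo : ∀ x → x < L → suc (absorbℕ x) ≡ shiftLo p (suc x)
  absorb-shiftLo x x<L = byCases (x <? p)
    where
    byCases : Dec (x < p) → suc (absorbℕ x) ≡ shiftLo p (suc x)
    byCases (yes x<p) = trans (cong suc (absorb-before x<p)) (sym (shiftLo-≤ x<p))
    byCases (no x≮p)  = trans (cong suc (absorb-after (≮⇒≥ x≮p) x<L)) (sym (shiftLo-> (s≤s (≮⇒≥ x≮p))))

  absorb-shiftHi : ∀ y → y < L → absorbℕ y ≡ shiftHi p y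
  absorb-shiftHi y y<L = byCases (y <? p)
    where
    byCases : Dec (y < p) → absorbℕ y ≡ shiftHi p y
    byCases (yes y<p) = trans (absorb-before y<p) (sym (shiftHi-< y<p))
    byCases (no y≮p)  = trans (absorb-after (≮⇒≥ y≮p) y<L) (sym (shiftHi-≥ (≮⇒≥ y≮p)))

  release-shiftLo : ∀ {y lo} → suc y ≡ shiftLo p lo → lo ≤ L → suc (releaseℕ y) ≡ lo
  release-shiftLo {y} {lo} y≡ lo≤L = byCases (lo ≤? p)
    where
    byCases : Dec (lo ≤ p) → suc (releaseℕ y) ≡ lo
    byCases (yes lo≤p) = trans (cong suc (release-before (subst (_≤ p) (sym y+1≡lo) lo≤p))) y+1≡lo
      where
      y+1≡lo : suc y ≡ lo
      y+1≡lo = trans y≡ (shiftLo-≤ lo≤p)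
    byCases (no lo≰p) = trans (cong suc (release-after (subst (p <_) (sym y≡lo) p<lo) (subst (_≤ L) (sym y≡lo) lo≤L)))
                              (trans (cong (λ n → suc (ℕ.pred n)) y≡lo) (suc-pred lo {{ℕ.>-nonZero (≤-<-trans z≤n p<lo)}}))
      where
      p<lo : p < lo
      p<lo = ≰⇒> lo≰p
      y≡lo : y ≡ lo
      y≡lo = suc-injective (trans y≡ (shiftLo-> p<lo))

  release-shiftHi : ∀ {y hi} → y ≡ shiftHi p hi → y < suc L → releaseℕ y ≡ hi × hi < L
  release-shiftHi {y} {hi} y≡ y<L+1 = byCases (hi <? p)
    where
    byCases : Dec (hi < p) → releaseℕ y ≡ hi × hi < L
    byCases (yes hi<p) = trans (release-before (subst (_< p) (sym y≡hi) hi<p)) y≡hi , <-≤-trans hi<p p≤L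
      where
      y≡hi : y ≡ hi
      y≡hi = trans y≡ (shiftHi-< hi<p)
    byCases (no hi≮p) = trans (release-after (subst (p <_) (sym y≡hi+1) (s≤s (≮⇒≥ hi≮p))) (s≤s⁻¹ y<L+1))
                              (cong ℕ.pred y≡hi+1)
                      , subst (_≤ L) y≡hi+1 (s≤s⁻¹ y<L+1)
      where
      y≡hi+1 : y ≡ suc hi
      y≡hi+1 = trans y≡ (shiftHi-≥ (≮⇒≥ hi≮p))

  Old New : Process
  Old = Pendant L (suc m) W
  New = Pendant (suc L) m (placeAt p W)

  NewPath : Fin (suc L + m) → Fin (suc L + m) → Set
  OldPath : Fin (L + suc m) → Fin (L + suc m) → Set
  NewPath = TransClosure (_⇒_ New)
  OldPath = TransClosure (_⇒_ Old)

  pendant-after-L : ∀ {x} k → x ≡ L + suc k → L < x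
  pendant-after-L {x} k x≡ = subst (L <_) (sym (trans x≡ (+-suc L k))) (s≤s (m≤m+n L k))

  -- Old edges become new paths.  The only edge that is not mapped to an edge is
  -- the trunk step from p - 1 to p, which now passes through the absorbed pendant.
  trunk⇒ : ∀ u v → TrunkStep L u v → NewPath (absorb u) (absorb v)
  trunk⇒ u v (v≡ , v<L) = byCases (<-cmp (suc (toℕ u)) p)
    where
    u<L : toℕ u < L
    u<L = <-trans (subst (toℕ u <_) (sym v≡) (n<1+n _)) v<L
    byCases : Tri (suc (toℕ u) < p) (suc (toℕ u) ≡ p) (p < suc (toℕ u)) → NewPath (absorb u) (absorb v)
    byCases (tri< u+1<p _ _) =
      [ inj₁ (trans av (trans v≡ (cong suc (sym au))) , subst (_< suc L) (sym av) (<-trans v<L (n<1+n L))) ]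
      where
      au : toℕ (absorb u) ≡ toℕ u
      au = trans (toℕ-absorb u) (absorb-before (<-trans (n<1+n _) u+1<p))
      av : toℕ (absorb v) ≡ toℕ v
      av = trans (toℕ-absorb v) (absorb-before (subst (_< p) (sym v≡) u+1<p))
    byCases (tri≈ _ u+1≡p _) =
      inj₁ (trans (toℕ-trunkAt p p<L+1) (trans (sym u+1≡p) (cong suc (sym au))) , subst (_< suc L) (sym (toℕ-trunkAt p p<L+1)) p<L+1)
      then [ inj₁ (trans av (cong suc (trans v≡ (trans u+1≡p (sym (toℕ-trunkAt p p<L+1))))) , subst (_< suc L) (sym av) (s≤s v<L)) ]
      where
      p<L+1 : p < suc L
      p<L+1 = s≤s p≤L
      au : toℕ (absorb u) ≡ toℕ u
      au = trans (toℕ-absorb u) (absorb-before (subst (toℕ u <_) u+1≡p (n<1+n _)))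
      av : toℕ (absorb v) ≡ suc (toℕ v)
      av = trans (toℕ-absorb v) (absorb-after (subst (p ≤_) (sym v≡) (≤-reflexive (sym u+1≡p))) v<L)
    byCases (tri> _ _ p<u+1) =
      [ inj₁ (trans av (cong suc (trans v≡ (sym au))) , subst (_< suc L) (sym av) (s≤s v<L)) ]
      where
      au : toℕ (absorb u) ≡ suc (toℕ u)
      au = trans (toℕ-absorb u) (absorb-after (s≤s⁻¹ p<u+1) u<L)
      av : toℕ (absorb v) ≡ suc (toℕ v)
      av = trans (toℕ-absorb v) (absorb-after (subst (p ≤_) (sym v≡) (<⇒≤ p<u+1)) v<L)

  -- In-edges of pendants: the absorbed one's becomes the trunk step p - 1 → p, the
  -- others move with their windows (absorb-shiftLo).
  into⇒ : ∀ u v → (Σ (Fin (suc m)) λ j → toℕ v ≡ L + toℕ j × suc (toℕ u) ≡ proj₁ (W j)) →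
          NewPath (absorb u) (absorb v)
  into⇒ u v (zero , v≡ , u+1≡lo) =
    [ inj₁ (trans av (trans (sym lo≡p) (trans (sym u+1≡lo) (cong suc (sym au)))) , subst (_< suc L) (sym av) (s≤s p≤L)) ]
    where
    av : toℕ (absorb v) ≡ p
    av = trans (toℕ-absorb v) (trans (cong absorbℕ (trans v≡ (+-identityʳ L))) absorb-placed)
    au : toℕ (absorb u) ≡ toℕ u
    au = trans (toℕ-absorb u) (absorb-before (subst (toℕ u <_) (trans u+1≡lo lo≡p) (n<1+n _)))
  into⇒ u v (suc j , v≡ , u+1≡lo) =
    [ inj₂ (inj₁ (j , trans av (trans v≡ (+-suc L (toℕ j))) ,
                  trans (cong suc au) (trans (absorb-shiftLo (toℕ u) u<L) (cong (shiftLo p) u+1≡lo)))) ]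
    where
    u<L : toℕ u < L
    u<L = subst (_≤ L) (sym u+1≡lo) (proj₁ (valid (suc j)))
    av : toℕ (absorb v) ≡ toℕ v
    av = trans (toℕ-absorb v) (absorb-pendant (pendant-after-L (toℕ j) v≡))
    au : toℕ (absorb u) ≡ absorbℕ (toℕ u)
    au = toℕ-absorb u

  -- Out-edges of pendants: the absorbed one's becomes the trunk step p → p + 1, the
  -- others move with their windows (absorb-shiftHi).
  outof⇒ : ∀ u v → (Σ (Fin (suc m)) λ j → toℕ u ≡ L + toℕ j × toℕ v ≡ proj₂ (W j) × proj₂ (W j) < L) →
           NewPath (absorb u) (absorb v)
  outof⇒ u v (zero , u≡ , v≡hi , hi<L) =
    [ inj₁ (trans av (cong suc (sym au)) , subst (_< suc L) (sym av) (s≤s p<L)) ]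
    where
    p<L : p < L
    p<L = subst (_< L) hi≡p hi<L
    au : toℕ (absorb u) ≡ p
    au = trans (toℕ-absorb u) (trans (cong absorbℕ (trans u≡ (+-identityʳ L))) absorb-placed)
    av : toℕ (absorb v) ≡ suc p
    av = trans (toℕ-absorb v) (trans (absorb-after (≤-reflexive (sym v≡p)) (subst (_< L) (sym v≡p) p<L)) (cong suc v≡p))
      where
      v≡p : toℕ v ≡ p
      v≡p = trans v≡hi hi≡p
  outof⇒ u v (suc j , u≡ , v≡hi , hi<L) =
    [ inj₂ (inj₂ (j , trans au (trans u≡ (+-suc L (toℕ j))) , trans av (cong (shiftHi p) v≡hi) ,
                  ≤-<-trans (shiftHi-≤-suc p _) (s≤s hi<L))) ]
    where
    au : toℕ (absorb u) ≡ toℕ u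
    au = trans (toℕ-absorb u) (absorb-pendant (pendant-after-L (toℕ j) u≡))
    av : toℕ (absorb v) ≡ shiftHi p (toℕ v)
    av = trans (toℕ-absorb v) (absorb-shiftHi (toℕ v) (subst (_< L) (sym v≡hi) hi<L))

  Old⇒New : ∀ u v → _⇒_ Old u v → NewPath (absorb u) (absorb v)
  Old⇒New u v (inj₁ step)         = trunk⇒ u v step
  Old⇒New u v (inj₂ (inj₁ edge)) = into⇒ u v edge
  Old⇒New u v (inj₂ (inj₂ edge)) = outof⇒ u v edge

  -- New edges become old paths (in fact old edges).  The new trunk steps into and
  -- out of position p are the edges of the absorbed pendant.
  trunk⇐ : ∀ u v → TrunkStep (suc L) u v → OldPath (release u) (release v)
  trunk⇐ u v (v≡ , v<L+1) = byCases (<-cmp (suc (toℕ u)) p)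
    where
    v≤L : toℕ v ≤ L
    v≤L = s≤s⁻¹ v<L+1
    byCases : Tri (suc (toℕ u) < p) (suc (toℕ u) ≡ p) (p < suc (toℕ u)) → OldPath (release u) (release v)
    byCases (tri< u+1<p _ _) =
      [ inj₁ (trans rv (trans v≡ (cong suc (sym ru))) , subst (_< L) (sym rv) (<-≤-trans v<p p≤L)) ]
      where
      v<p : toℕ v < p
      v<p = subst (_< p) (sym v≡) u+1<p
      ru : toℕ (release u) ≡ toℕ u
      ru = trans (toℕ-release u) (release-before (<-trans (n<1+n _) u+1<p))
      rv : toℕ (release v) ≡ toℕ v
      rv = trans (toℕ-release v) (release-before v<p)
    byCases (tri≈ _ u+1≡p _) =
      [ inj₂ (inj₁ (zero , trans rv (sym (+-identityʳ L)) , trans (cong suc ru) (trans u+1≡p (sym lo≡p)))) ]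
      where
      ru : toℕ (release u) ≡ toℕ u
      ru = trans (toℕ-release u) (release-before (subst (toℕ u <_) u+1≡p (n<1+n _)))
      rv : toℕ (release v) ≡ L
      rv = trans (toℕ-release v) (trans (cong releaseℕ (trans v≡ u+1≡p)) release-placed)
    byCases (tri> _ _ p<u+1) with m≤n⇒m<n∨m≡n (s≤s⁻¹ p<u+1)
    ... | inj₂ p≡u =
      [ inj₂ (inj₂ (zero , trans ru (sym (+-identityʳ L)) , trans rv (sym hi≡p) , subst (_< L) (sym hi≡p) p<L)) ]
      where
      p<L : p < L
      p<L = subst (_≤ L) (trans v≡ (cong suc (sym p≡u))) v≤L
      ru : toℕ (release u) ≡ L
      ru = trans (toℕ-release u) (trans (cong releaseℕ (sym p≡u)) release-placed)
      rv : toℕ (release v) ≡ p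
      rv = trans (toℕ-release v) (trans (release-after (subst (p <_) (sym v≡) p<u+1) v≤L) (trans (cong ℕ.pred v≡) (sym p≡u)))
    ... | inj₁ p<u =
      [ inj₁ (trans rv (sym ru) , subst (_< L) (sym rv) u<L) ]
      where
      u<L : toℕ u < L
      u<L = subst (_≤ L) v≡ v≤L
      ru : suc (toℕ (release u)) ≡ toℕ u
      ru = trans (cong suc (trans (toℕ-release u) (release-after p<u (<⇒≤ u<L))))
                 (suc-pred (toℕ u) {{ℕ.>-nonZero (≤-<-trans z≤n p<u)}})
      rv : toℕ (release v) ≡ toℕ u
      rv = trans (toℕ-release v) (trans (release-after (subst (p <_) (sym v≡) p<u+1) v≤L) (cong ℕ.pred v≡))

  into⇐ : ∀ u v → (Σ (Fin m) λ j → toℕ v ≡ suc L + toℕ j × suc (toℕ u) ≡ proj₁ (placeAt p W j)) →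
          OldPath (release u) (release v)
  into⇐ u v (j , v≡ , u+1≡lo) =
    [ inj₂ (inj₁ (suc j , trans rv (trans v≡ (sym (+-suc L (toℕ j)))) ,
                  trans (cong suc (toℕ-release u)) (release-shiftLo u+1≡lo (proj₁ (valid (suc j)))))) ]
    where
    rv : toℕ (release v) ≡ toℕ v
    rv = trans (toℕ-release v) (release-pendant (subst (L <_) (sym v≡) (s≤s (m≤m+n L (toℕ j)))))

  outof⇐ : ∀ u v → (Σ (Fin m) λ j → toℕ u ≡ suc L + toℕ j × toℕ v ≡ proj₂ (placeAt p W j) ×
                                     proj₂ (placeAt p W j) < suc L) →
           OldPath (release u) (release v)
  outof⇐ u v (j , u≡ , v≡hi , hi<L+1) =
    [ inj₂ (inj₂ (suc j , trans ru (trans u≡ (sym (+-suc L (toℕ j)))) ,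
                  trans (toℕ-release v) (proj₁ released) , proj₂ released)) ]
    where
    ru : toℕ (release u) ≡ toℕ u
    ru = trans (toℕ-release u) (release-pendant (subst (L <_) (sym u≡) (s≤s (m≤m+n L (toℕ j)))))
    released : releaseℕ (toℕ v) ≡ proj₂ (W (suc j)) × proj₂ (W (suc j)) < L
    released = release-shiftHi v≡hi (subst (_< suc L) (sym v≡hi) hi<L+1)

  New⇒Old : ∀ u v → _⇒_ New u v → OldPath (release u) (release v)
  New⇒Old u v (inj₁ step)         = trunk⇐ u v step
  New⇒Old u v (inj₂ (inj₁ edge)) = into⇐ u v edge
  New⇒Old u v (inj₂ (inj₂ edge)) = outof⇐ u v edge

  runs≅ : Inverse (RunSetoid Old) (RunSetoid New)
  runs≅ = relabel Old New (+-suc L m) absorb release absorb∘release release∘absorb Old⇒New New⇒Old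

σ-absorb : ∀ L m p (W : Vector Window (suc m)) → Valid L W →
           proj₁ (W zero) ≡ p → proj₂ (W zero) ≡ p → ∀ {c} →
           σ≡ (Pendant (suc L) m (placeAt p W)) c → σ≡ (Pendant L (suc m) W) c
σ-absorb L m p W valid lo≡p hi≡p = σ-along (Absorption.runs≅ L m p p≤L W valid lo≡p hi≡p)
  where
  p≤L : p ≤ L
  p≤L = subst (_≤ L) lo≡p (proj₁ (valid zero))

-- For lo < hi, compare the first pendant with the trunk action
-- lo.  Runs with the pendant first are the runs with the pendant pinned to gap lo;
-- runs with the trunk action first are those with its window narrowed to (lo + 1 , hi).
module WindowSplit (L m : ℕ) (W : Vector Window (suc m)) (valid : Valid L W)
                   (lo<hi : proj₁ (head W) < proj₂ (head W)) where

  lo hi : ℕ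
  lo = proj₁ (head W)
  hi = proj₂ (head W)

  Lowest Higher : Vector Window (suc m)
  Lowest = (lo , lo) ∷ tail W
  Higher = (suc lo , hi) ∷ tail W

  P : Process
  P = Pendant L (suc m) W

  lo<L : lo < L
  lo<L = <-≤-trans lo<hi (proj₂ (valid zero))

  lowest-valid : Valid L Lowest
  lowest-valid zero    = <⇒≤ lo<L , <⇒≤ lo<L
  lowest-valid (suc j) = valid (suc j)

  higher-valid : Valid L Higher
  higher-valid zero    = lo<L , proj₂ (valid zero)
  higher-valid (suc j) = valid (suc j)

  first trunkLo : Fin (L + suc m)
  first   = pendantAt zero
  trunkLo = trunkAt lo lo<L

  first≡ : toℕ first ≡ L + 0
  first≡ = toℕ-pendantAt zero

  first≢trunkLo : first ≢ trunkLo
  first≢trunkLo first≡trunkLo = <-irrefl (sym L≡lo) lo<L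
    where
    L≡lo : L ≡ lo
    L≡lo = trans (sym (trans first≡ (+-identityʳ L))) (trans (cong toℕ first≡trunkLo) (toℕ-trunkAt lo lo<L))

  -- Pendant before trunk action lo: the added edge is the new out-edge of the
  -- pendant, and its old out-edge (to hi) is recovered through the trunk.
  lowest≅ : Inverse (RunSetoid (addEdge P first trunkLo)) (RunSetoid (Pendant L (suc m) Lowest))
  lowest≅ = relabel (addEdge P first trunkLo) (Pendant L (suc m) Lowest) refl id id (λ _ → refl) (λ _ → refl) to from
    where
    to : ∀ u v → _⇒_ (addEdge P first trunkLo) u v → TransClosure (PendantEdge L (suc m) Lowest) u v
    to u v (inj₁ (inj₁ step))                        = [ inj₁ step ]
    to u v (inj₁ (inj₂ (inj₁ (zero , edge))))        = [ inj₂ (inj₁ (zero , edge)) ]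
    to u v (inj₁ (inj₂ (inj₁ (suc j , edge))))       = [ inj₂ (inj₁ (suc j , edge)) ]
    to u v (inj₁ (inj₂ (inj₂ (zero , u≡ , v≡ , hi<L)))) =
      inj₂ (inj₂ (zero , u≡ , toℕ-trunkAt lo lo<L , lo<L))
      then trunk-path inj₁ trunkLo v (subst₂ _<_ (sym (toℕ-trunkAt lo lo<L)) (sym v≡) lo<hi) (subst (_< L) (sym v≡) hi<L)
    to u v (inj₁ (inj₂ (inj₂ (suc j , edge))))       = [ inj₂ (inj₂ (suc j , edge)) ]
    to u v (inj₂ (refl , refl))                      = [ inj₂ (inj₂ (zero , first≡ , toℕ-trunkAt lo lo<L , lo<L)) ]
    from : ∀ u v → PendantEdge L (suc m) Lowest u v → TransClosure (_⇒_ (addEdge P first trunkLo)) u v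
    from u v (inj₁ step)                       = [ inj₁ (inj₁ step) ]
    from u v (inj₂ (inj₁ (zero , edge)))       = [ inj₁ (inj₂ (inj₁ (zero , edge))) ]
    from u v (inj₂ (inj₁ (suc j , edge)))      = [ inj₁ (inj₂ (inj₁ (suc j , edge))) ]
    from u v (inj₂ (inj₂ (zero , u≡ , v≡ , _))) =
      [ inj₂ (toℕ-injective (trans u≡ (sym first≡)) , toℕ-injective (trans v≡ (sym (toℕ-trunkAt lo lo<L)))) ]
    from u v (inj₂ (inj₂ (suc j , edge)))      = [ inj₁ (inj₂ (inj₂ (suc j , edge))) ]

  -- Trunk action lo before the pendant: the added edge is the new in-edge of the
  -- pendant, and its old in-edge (from lo - 1) is recovered through the trunk.
  higher≅ : Inverse (RunSetoid (addEdge P trunkLo first)) (RunSetoid (Pendant L (suc m) Higher))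
  higher≅ = relabel (addEdge P trunkLo first) (Pendant L (suc m) Higher) refl id id (λ _ → refl) (λ _ → refl) to from
    where
    to : ∀ u v → _⇒_ (addEdge P trunkLo first) u v → TransClosure (PendantEdge L (suc m) Higher) u v
    to u v (inj₁ (inj₁ step))                  = [ inj₁ step ]
    to u v (inj₁ (inj₂ (inj₁ (zero , v≡ , u+1≡lo)))) =
      inj₁ (trans (toℕ-trunkAt lo lo<L) (sym u+1≡lo) , subst (_< L) (sym (toℕ-trunkAt lo lo<L)) lo<L)
      then [ inj₂ (inj₁ (zero , v≡ , cong suc (toℕ-trunkAt lo lo<L))) ]
    to u v (inj₁ (inj₂ (inj₁ (suc j , edge)))) = [ inj₂ (inj₁ (suc j , edge)) ]
    to u v (inj₁ (inj₂ (inj₂ (zero , edge))))  = [ inj₂ (inj₂ (zero , edge)) ]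
    to u v (inj₁ (inj₂ (inj₂ (suc j , edge)))) = [ inj₂ (inj₂ (suc j , edge)) ]
    to u v (inj₂ (refl , refl))                = [ inj₂ (inj₁ (zero , first≡ , cong suc (toℕ-trunkAt lo lo<L))) ]
    from : ∀ u v → PendantEdge L (suc m) Higher u v → TransClosure (_⇒_ (addEdge P trunkLo first)) u v
    from u v (inj₁ step)                  = [ inj₁ (inj₁ step) ]
    from u v (inj₂ (inj₁ (zero , v≡ , u+1≡lo+1))) =
      [ inj₂ (toℕ-injective (trans (suc-injective u+1≡lo+1) (sym (toℕ-trunkAt lo lo<L))) , toℕ-injective (trans v≡ (sym first≡))) ]
    from u v (inj₂ (inj₁ (suc j , edge))) = [ inj₁ (inj₂ (inj₁ (suc j , edge))) ]
    from u v (inj₂ (inj₂ (zero , edge)))  = [ inj₁ (inj₂ (inj₂ (zero , edge))) ]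
    from u v (inj₂ (inj₂ (suc j , edge))) = [ inj₁ (inj₂ (inj₂ (suc j , edge))) ]

  σ-windowSplit : ∀ {a c} → σ≡ (Pendant L (suc m) Lowest) a → σ≡ (Pendant L (suc m) Higher) c → σ≡ P (a + c)
  σ-windowSplit I J = σ-split P first trunkLo first≢trunkLo (σ-along lowest≅ I) (σ-along higher≅ J)

-- Counting by the first pendant's window: induction on its length suc hi ∸ lo,
-- splitting off the lowest gap until the window is a single gap (absorbed) or empty.
σ-firstPendant : ∀ m → (∀ L (V : Vector Window m) → Valid L V → σ≡ (Pendant L m V) (count m V)) →
                 ∀ len L (W : Vector Window (suc m)) → Valid L W → suc (proj₂ (head W)) ∸ proj₁ (head W) ≡ len →
                 σ≡ (Pendant L (suc m) W) (sumFrom (proj₁ (head W)) len (λ p → count m (placeAt p W)))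
σ-firstPendant m σ-rest zero L W valid len≡0 = σ-emptyWindow L m W valid (m∸n≡0⇒m≤n len≡0)
σ-firstPendant m σ-rest (suc len) L W valid len≡ with <-cmp (proj₁ (head W)) (proj₂ (head W))
... | tri< lo<hi _ _ =
  σ-windowSplit (σ-absorb L m lo Lowest lowest-valid refl refl (σ-rest (suc L) (placeAt lo W) (placeAt-valid L W lo valid)))
                (σ-firstPendant m σ-rest len L Higher higher-valid (suc-injective (trans (sym (+-∸-assoc 1 (<⇒≤ lo<hi))) len≡)))
  where open WindowSplit L m W valid lo<hi
... | tri≈ _ lo≡hi _ =
  subst (λ l → σ≡ (Pendant L (suc m) W) (sumFrom lo (suc l) (λ p → count m (placeAt p W)))) len≡0
        (subst (σ≡ (Pendant L (suc m) W)) (sym (+-identityʳ _))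
               (σ-absorb L m lo W valid refl (sym lo≡hi) (σ-rest (suc L) (placeAt lo W) (placeAt-valid L W lo valid))))
  where
  lo : ℕ
  lo = proj₁ (head W)
  len≡0 : 0 ≡ len
  len≡0 = suc-injective (trans (sym (trans (cong (λ h → suc h ∸ lo) (sym lo≡hi)) (m+n∸n≡m 1 lo))) len≡)
... | tri> _ _ hi<lo = ⊥-elim (1+n≢0 (trans (sym len≡) (m≤n⇒m∸n≡0 hi<lo)))

σ-pendant : ∀ m L (W : Vector Window m) → Valid L W → σ≡ (Pendant L m W) (count m W)
σ-pendant zero    L W valid = σ-trunk L W
σ-pendant (suc m) L W valid = σ-firstPendant m (σ-pendant m) _ L W valid refl

sumFrom-cong : ∀ a m {f g : ℕ → ℕ} → (∀ i → i < m → f (a + i) ≡ g (a + i)) → sumFrom a m f ≡ sumFrom a m g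
sumFrom-cong a zero    eq = refl
sumFrom-cong a (suc m) {f} {g} eq =
  cong₂ _+_ (subst (λ x → f x ≡ g x) (+-identityʳ a) (eq 0 z<s))
            (sumFrom-cong (suc a) m (λ i i<m → subst (λ x → f x ≡ g x) (+-suc a i) (eq (suc i) (s<s i<m))))

sumFrom-index< : ∀ a {b i} → i < b ∸ a → a + i < b
sumFrom-index< zero            i<b   = i<b
sumFrom-index< (suc a) {zero}  ()
sumFrom-index< (suc a) {suc b} i<b∸a = s<s (sumFrom-index< a i<b∸a)

sumFrom-ext : ∀ a m {f g : ℕ → ℕ} → (∀ p → f p ≡ g p) → sumFrom a m f ≡ sumFrom a m g
sumFrom-ext a m eq = sumFrom-cong a m (λ i _ → eq (a + i))

sumFrom-split : ∀ a m n f → sumFrom a (m + n) f ≡ sumFrom a m f + sumFrom (a + m) n f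
sumFrom-split a zero    n f = cong (λ b → sumFrom b n f) (sym (+-identityʳ a))
sumFrom-split a (suc m) n f = begin
  f a + sumFrom (suc a) (m + n) f                              ≡⟨ cong (f a +_) (sumFrom-split (suc a) m n f) ⟩
  f a + (sumFrom (suc a) m f + sumFrom (suc a + m) n f)        ≡⟨ sym (+-assoc (f a) _ _) ⟩
  f a + sumFrom (suc a) m f + sumFrom (suc a + m) n f          ≡⟨ cong (λ b → f a + sumFrom (suc a) m f + sumFrom b n f) (sym (+-suc a m)) ⟩
  f a + sumFrom (suc a) m f + sumFrom (a + suc m) n f          ∎
  where open ≡-Reasoning

sumFrom-const : ∀ a m f c → (∀ i → i < m → f (a + i) ≡ c) → sumFrom a m f ≡ m * c
sumFrom-const a m f c eq = trans (sumFrom-cong a m {g = λ _ → c} eq) (constant a m)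
  where
  constant : ∀ a m → sumFrom a m (λ _ → c) ≡ m * c
  constant a zero    = refl
  constant a (suc m) = cong (c +_) (constant (suc a) m)

sumFrom-* : ∀ a m c f → sumFrom a m (λ p → c * f p) ≡ c * sumFrom a m f
sumFrom-* a zero    c f = sym (*-zeroʳ c)
sumFrom-* a (suc m) c f = trans (cong (c * f a +_) (sumFrom-* (suc a) m c f)) (sym (*-distribˡ-+ c (f a) _))

sumFrom-mirror : ∀ m a s f → a + m ≤ suc s → sumFrom a m (λ p → f (s ∸ p)) ≡ sumFrom (suc s ∸ (a + m)) m f
sumFrom-mirror zero    a s f _  = refl
sumFrom-mirror (suc m) a s f a+m+1≤s+1 = begin
  f (s ∸ a) + sumFrom (suc a) m (λ p → f (s ∸ p))  ≡⟨ cong (f (s ∸ a) +_) (sumFrom-mirror m (suc a) s f a+1+m≤s+1) ⟩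
  f (s ∸ a) + sumFrom b m f                        ≡⟨ +-comm (f (s ∸ a)) _ ⟩
  sumFrom b m f + f (s ∸ a)                        ≡⟨ cong (λ x → sumFrom b m f + f x) b+m≡s∸a ⟨
  sumFrom b m f + f (b + m)                        ≡⟨ cong (sumFrom b m f +_) (+-identityʳ _) ⟨
  sumFrom b m f + sumFrom (b + m) 1 f              ≡⟨ sumFrom-split b m 1 f ⟨
  sumFrom b (m + 1) f                              ≡⟨ cong₂ (λ x y → sumFrom (suc s ∸ x) y f) (+-suc a m) (+-comm 1 m) ⟨
  sumFrom (suc s ∸ (a + suc m)) (suc m) f          ∎
  where
  open ≡-Reasoning
  a+1+m≤s+1 : suc a + m ≤ suc s
  a+1+m≤s+1 = subst (_≤ suc s) (+-suc a m) a+m+1≤s+1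
  b : ℕ
  b = s ∸ (a + m)
  b+m≡s∸a : b + m ≡ s ∸ a
  b+m≡s∸a = begin
    s ∸ (a + m) + m ≡⟨ cong (_+ m) (∸-+-assoc s a m) ⟨
    s ∸ a ∸ m + m   ≡⟨ m∸n+n≡m (m+n≤o⇒m≤o∸n m (subst (_≤ s) (+-comm a m) (s≤s⁻¹ a+1+m≤s+1))) ⟩
    s ∸ a           ∎

count-cong : ∀ m {W V : Vector Window m} → (∀ j → W j ≡ V j) → count m W ≡ count m V
count-cong zero    eq = refl
count-cong (suc m) {W} {V} eq =
  trans (cong (λ w → sumFrom (proj₁ w) (suc (proj₂ w) ∸ proj₁ w) (λ p → count m (placeAt p W))) (eq zero))
        (sumFrom-ext (proj₁ (V zero)) (suc (proj₂ (V zero)) ∸ proj₁ (V zero))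
                     (λ p → count-cong m (λ j → cong (shiftWindow p) (eq (suc j)))))

permutePendants : ∀ {L m} → (Fin m → Fin m) → Fin (L + m) → Fin (L + m)
permutePendants {L} {m} σ x = [ (_↑ˡ m) , (λ j → L ↑ʳ σ j) ]′ (splitAt L x)

permutePendants-inverse : ∀ {L m} (σ τ : Fin m → Fin m) → (∀ j → σ (τ j) ≡ j) →
                          ∀ x → permutePendants {L} σ (permutePendants τ x) ≡ x
permutePendants-inverse {L} {m} σ τ στ x with splitAt L x in eq
... | inj₁ i rewrite splitAt-↑ˡ L i m          = splitAt⁻¹-↑ˡ eq
... | inj₂ j rewrite splitAt-↑ʳ L m (τ j) | στ j = splitAt⁻¹-↑ʳ eq

permutePendants-trunk : ∀ {L m} (σ : Fin m → Fin m) (x : Fin (L + m)) → toℕ x < L →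
                        toℕ (permutePendants {L} σ x) ≡ toℕ x
permutePendants-trunk {L} {m} σ x x<L with splitAt L x in eq
... | inj₁ i = cong toℕ (splitAt⁻¹-↑ˡ eq)
... | inj₂ j = ⊥-elim (<⇒≱ x<L (subst (L ≤_) (trans (sym (toℕ-↑ʳ L j)) (cong toℕ (splitAt⁻¹-↑ʳ eq))) (m≤m+n L (toℕ j))))

permutePendants-pendant : ∀ {L m} (σ : Fin m → Fin m) (x : Fin (L + m)) (j : Fin m) → toℕ x ≡ L + toℕ j →
                          toℕ (permutePendants {L} σ x) ≡ L + toℕ (σ j)
permutePendants-pendant {L} {m} σ x j x≡ with splitAt L x in eq
... | inj₁ i = ⊥-elim (<⇒≱ (subst (_< L) (trans (sym (toℕ-↑ˡ i m)) (cong toℕ (splitAt⁻¹-↑ˡ eq))) (toℕ<n i))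
                          (subst (L ≤_) (sym x≡) (m≤m+n L (toℕ j))))
... | inj₂ j′ = trans (toℕ-↑ʳ L (σ j′)) (cong (λ i → L + toℕ (σ i)) j′≡j)
  where
  j′≡j : j′ ≡ j
  j′≡j = toℕ-injective (+-cancelˡ-≡ L _ _ (trans (sym (toℕ-↑ʳ L j′)) (trans (cong toℕ (splitAt⁻¹-↑ʳ eq)) x≡)))

permutePendants-edge : ∀ L m (W₁ W₂ : Vector Window m) (σ : Fin m → Fin m) → Valid L W₁ → (∀ j → W₁ j ≡ W₂ (σ j)) →
  ∀ u v → PendantEdge L m W₁ u v → TransClosure (PendantEdge L m W₂) (permutePendants σ u) (permutePendants σ v)
permutePendants-edge L m W₁ W₂ σ valid same u v (inj₁ (v≡ , v<L)) =
  [ inj₁ (trans (permutePendants-trunk σ v v<L) (trans v≡ (cong suc (sym (permutePendants-trunk σ u u<L)))) ,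
          subst (_< L) (sym (permutePendants-trunk σ v v<L)) v<L) ]
  where
  u<L : toℕ u < L
  u<L = <-trans (subst (toℕ u <_) (sym v≡) (n<1+n _)) v<L
permutePendants-edge L m W₁ W₂ σ valid same u v (inj₂ (inj₁ (j , v≡ , u+1≡lo))) =
  [ inj₂ (inj₁ (σ j , permutePendants-pendant σ v j v≡ ,
                trans (cong suc (permutePendants-trunk σ u u<L)) (trans u+1≡lo (cong proj₁ (same j))))) ]
  where
  u<L : toℕ u < L
  u<L = subst (_≤ L) (sym u+1≡lo) (proj₁ (valid j))
permutePendants-edge L m W₁ W₂ σ valid same u v (inj₂ (inj₂ (j , u≡ , v≡hi , hi<L))) =
  [ inj₂ (inj₂ (σ j , permutePendants-pendant σ u j u≡ ,
                trans (permutePendants-trunk σ v v<L) (trans v≡hi (cong proj₂ (same j))) ,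
                subst (_< L) (cong proj₂ (same j)) hi<L)) ]
  where
  v<L : toℕ v < L
  v<L = subst (_< L) (sym v≡hi) hi<L

-- The count does not depend on the order of the pendants: both orders count the
-- runs of isomorphic processes.
count-permute : ∀ {m} L (W : Vector Window m) (ρ : Permutation′ m) → Valid L W →
                count m (W ∘ (ρ ⟨$⟩ʳ_)) ≡ count m W
count-permute {m} L W ρ valid =
  σ-unique (σ-pendant m L (W ∘ (ρ ⟨$⟩ʳ_)) (valid ∘ (ρ ⟨$⟩ʳ_)))
           (σ-along (relabel (Pendant L m (W ∘ (ρ ⟨$⟩ʳ_))) (Pendant L m W) refl
                             (permutePendants (ρ ⟨$⟩ʳ_)) (permutePendants (ρ ⟨$⟩ˡ_))
                             (permutePendants-inverse _ _ (λ j → inverseʳ ρ))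
                             (permutePendants-inverse _ _ (λ j → inverseˡ ρ))
                             (permutePendants-edge L m _ W (ρ ⟨$⟩ʳ_) (valid ∘ (ρ ⟨$⟩ʳ_)) (λ j → refl))
                             (permutePendants-edge L m W _ (ρ ⟨$⟩ˡ_) valid (λ j → cong W (sym (inverseʳ ρ)))))
                    (σ-pendant m L W valid))

reverseWindow : ℕ → Window → Window
reverseWindow L (lo , hi) = L ∸ hi , L ∸ lo

flip-∸≤ : ∀ {L a b} → a ≤ L → L ∸ a ≤ b → L ∸ b ≤ a
flip-∸≤ {L} {a} {b} a≤L h = subst (L ∸ b ≤_) (m∸[m∸n]≡n a≤L) (∸-monoʳ-≤ L h)

flip-≤∸ : ∀ {L a b} → a ≤ L → b ≤ L ∸ a → a ≤ L ∸ b
flip-≤∸ {L} {a} {b} a≤L h = subst (_≤ L ∸ b) (m∸[m∸n]≡n a≤L) (∸-monoʳ-≤ L h)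

shiftWindow-reverse : ∀ {L p} (w : Window) → p ≤ L → proj₁ w ≤ L → proj₂ w ≤ L →
                      shiftWindow p (reverseWindow L w) ≡ reverseWindow (suc L) (shiftWindow (L ∸ p) w)
shiftWindow-reverse {L} {p} (lo , hi) p≤L lo≤L hi≤L = cong₂ _,_ newLo newHi
  where
  newLo : shiftLo p (L ∸ hi) ≡ suc L ∸ shiftHi (L ∸ p) hi
  newLo with hi <? L ∸ p
  ... | no hi≮L∸p = trans (shiftLo-≤ (flip-∸≤ p≤L (≮⇒≥ hi≮L∸p))) (sym (cong (suc L ∸_) (shiftHi-≥ (≮⇒≥ hi≮L∸p))))
  ... | yes hi<L∸p = trans (shiftLo-> p<L∸hi) (sym (trans (cong (suc L ∸_) (shiftHi-< hi<L∸p)) (+-∸-assoc 1 hi≤L)))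
    where
    p<L∸hi : p < L ∸ hi
    p<L∸hi with p <? L ∸ hi
    ... | yes q = q
    ... | no q  = ⊥-elim (<⇒≱ hi<L∸p (flip-∸≤ hi≤L (≮⇒≥ q)))
  newHi : shiftHi p (L ∸ lo) ≡ suc L ∸ shiftLo (L ∸ p) lo
  newHi with L ∸ p <? lo
  ... | no L∸p≮lo = trans (shiftHi-≥ (flip-≤∸ p≤L (≮⇒≥ L∸p≮lo)))
                          (sym (trans (cong (suc L ∸_) (shiftLo-≤ (≮⇒≥ L∸p≮lo))) (+-∸-assoc 1 lo≤L)))
  ... | yes L∸p<lo = trans (shiftHi-< L∸lo<p) (sym (cong (suc L ∸_) (shiftLo-> L∸p<lo)))
    where
    L∸lo<p : L ∸ lo < p
    L∸lo<p with L ∸ lo <? p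
    ... | yes q = q
    ... | no q  = ⊥-elim (<⇒≱ L∸p<lo (flip-≤∸ lo≤L (≮⇒≥ q)))

reverseWindow-gaps : ∀ {L lo hi} → lo ≤ hi → hi ≤ L → suc (L ∸ lo) ∸ (L ∸ hi) ≡ suc hi ∸ lo
reverseWindow-gaps {L} {lo} {hi} lo≤hi hi≤L = begin
  suc (L ∸ lo) ∸ (L ∸ hi)              ≡⟨ cong (λ x → suc x ∸ (L ∸ hi)) split ⟨
  suc (L ∸ hi + (hi ∸ lo)) ∸ (L ∸ hi)  ≡⟨ cong (_∸ (L ∸ hi)) (+-suc (L ∸ hi) (hi ∸ lo)) ⟨
  L ∸ hi + suc (hi ∸ lo) ∸ (L ∸ hi)    ≡⟨ m+n∸m≡n (L ∸ hi) _ ⟩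
  suc (hi ∸ lo)                        ≡⟨ +-∸-assoc 1 lo≤hi ⟨
  suc hi ∸ lo                          ∎
  where
  open ≡-Reasoning
  split : L ∸ hi + (hi ∸ lo) ≡ L ∸ lo
  split = trans (sym (+-∸-assoc (L ∸ hi) lo≤hi)) (cong (_∸ lo) (m∸n+n≡m hi≤L))

-- The first pendant placed in gap
-- p of the reversed trunk corresponds to gap L ∸ p of the original one, so the two
-- sums agree term by term after mirroring the range of summation.
count-reverse : ∀ m L (W : Vector Window m) → Valid L W → count m (reverseWindow L ∘ W) ≡ count m W
count-reverse zero    L W valid = refl
count-reverse (suc m) L W valid with proj₁ (W zero) ≤? proj₂ (W zero)
... | yes lo≤hi = begin
  sumFrom (L ∸ hi) gaps (λ p → count m (placeAt p (reverseWindow L ∘ W)))  ≡⟨ sumFrom-cong (L ∸ hi) gaps mirrored ⟩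
  sumFrom (L ∸ hi) gaps (λ p → G (L ∸ p))                                   ≡⟨ sumFrom-mirror gaps (L ∸ hi) L G end≤ ⟩
  sumFrom (suc L ∸ (L ∸ hi + gaps)) gaps G                                  ≡⟨ cong₂ (λ a b → sumFrom a b G) start≡lo gaps≡ ⟩
  sumFrom lo (suc hi ∸ lo) G                                                ∎
  where
  open ≡-Reasoning
  lo hi : ℕ
  lo = proj₁ (W zero)
  hi = proj₂ (W zero)
  lo≤L : lo ≤ L
  lo≤L = proj₁ (valid zero)
  hi≤L : hi ≤ L
  hi≤L = proj₂ (valid zero)
  G : ℕ → ℕ
  G q = count m (placeAt q W)
  gaps : ℕ
  gaps = suc (L ∸ lo) ∸ (L ∸ hi)
  gaps≡ : gaps ≡ suc hi ∸ lo
  gaps≡ = reverseWindow-gaps lo≤hi hi≤L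
  end≡ : L ∸ hi + gaps ≡ suc (L ∸ lo)
  end≡ = m+[n∸m]≡n (≤-trans (∸-monoʳ-≤ L lo≤hi) (n≤1+n _))
  end≤ : L ∸ hi + gaps ≤ suc L
  end≤ = subst (_≤ suc L) (sym end≡) (s≤s (m∸n≤m L lo))
  start≡lo : suc L ∸ (L ∸ hi + gaps) ≡ lo
  start≡lo = trans (cong (suc L ∸_) end≡) (m∸[m∸n]≡n lo≤L)
  mirrored : ∀ i → i < gaps → count m (placeAt (L ∸ hi + i) (reverseWindow L ∘ W)) ≡ G (L ∸ (L ∸ hi + i))
  mirrored i i<gaps =
    trans (count-cong m (λ j → shiftWindow-reverse (W (suc j)) p≤L (proj₁ (valid (suc j))) (proj₂ (valid (suc j)))))
          (count-reverse m (suc L) (placeAt (L ∸ p) W) (placeAt-valid L W (L ∸ p) valid))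
    where
    p : ℕ
    p = L ∸ hi + i
    p≤L : p ≤ L
    p≤L = ≤-trans (s≤s⁻¹ (subst (p <_) end≡ (+-monoʳ-< (L ∸ hi) i<gaps))) (m∸n≤m L lo)
... | no lo≰hi = trans (cong (λ s → sumFrom (L ∸ hi) s (λ p → count m (placeAt p (reverseWindow L ∘ W))))
                             (m≤n⇒m∸n≡0 (∸-monoʳ-< hi<lo (proj₁ (valid zero)))))
                       (sym (cong (λ s → sumFrom lo s (λ p → count m (placeAt p W))) (m≤n⇒m∸n≡0 hi<lo)))
  where
  lo hi : ℕ
  lo = proj₁ (W zero)
  hi = proj₂ (W zero)
  hi<lo : hi < lo
  hi<lo = ≰⇒> lo≰hi

count-pinned : ∀ m p (V : Vector Window m) → count (suc m) ((p , p) ∷ V) ≡ count m (map (shiftWindow p) V)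
count-pinned m p V = trans (cong (λ g → sumFrom p g (λ q → count m (map (shiftWindow q) V))) (m+n∸n≡m 1 p))
                           (+-identityʳ _)

-- Swap it
-- behind the first pendant: after that pendant is placed in any gap r, the free
-- pendant is still free on the longer trunk.
count-freePendant : ∀ m L (W : Vector Window m) → Valid L W → count (suc m) ((0 , L) ∷ W) ≡ suc (L + m) * count m W
count-freePendant zero L W valid = trans (sumFrom-const 0 (suc L) _ 1 (λ _ _ → refl)) (cong (λ x → suc x * 1) (sym (+-identityʳ L)))
count-freePendant (suc m) L W valid = begin
  count (2 + m) V                                              ≡⟨ count-permute L V swap₀₁ valid′ ⟨
  count (2 + m) (V ∘ (swap₀₁ ⟨$⟩ʳ_))                            ≡⟨ count-cong (2 + m) swapped ⟩
  count (2 + m) (W zero ∷ (0 , L) ∷ tail W)                    ≡⟨ sumFrom-cong lo gaps placed ⟩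
  sumFrom lo gaps (λ r → K * count m (placeAt r W))            ≡⟨ sumFrom-* lo gaps K _ ⟩
  K * count (suc m) W                                          ≡⟨ cong (λ x → suc x * count (suc m) W) (+-suc L m) ⟨
  suc (L + suc m) * count (suc m) W                            ∎
  where
  open ≡-Reasoning
  V : Vector Window (2 + m)
  V = (0 , L) ∷ W
  lo gaps K : ℕ
  lo = proj₁ (W zero)
  gaps = suc (proj₂ (W zero)) ∸ lo
  K = suc (suc L + m)
  swap₀₁ : Permutation′ (2 + m)
  swap₀₁ = transpose zero (suc zero)
  valid′ : Valid L V
  valid′ zero    = z≤n , ≤-refl
  valid′ (suc j) = valid j
  swapped : ∀ j → V (swap₀₁ ⟨$⟩ʳ j) ≡ (W zero ∷ (0 , L) ∷ tail W) j
  swapped zero          = refl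
  swapped (suc zero)    = refl
  swapped (suc (suc j)) = refl
  placed : ∀ i → i < gaps →
           count (suc m) (placeAt (lo + i) (W zero ∷ (0 , L) ∷ tail W)) ≡ K * count m (placeAt (lo + i) W)
  placed i i<gaps = trans (count-cong (suc m) stillFree)
                          (count-freePendant m (suc L) (placeAt r W) (placeAt-valid L W r valid))
    where
    r : ℕ
    r = lo + i
    r≤L : r ≤ L
    r≤L = ≤-trans (s≤s⁻¹ (sumFrom-index< lo i<gaps)) (proj₂ (valid zero))
    stillFree : ∀ j → placeAt r (W zero ∷ (0 , L) ∷ tail W) j ≡ ((0 , suc L) ∷ placeAt r W) j
    stillFree zero    = cong₂ _,_ (shiftLo-≤ {r} z≤n) (shiftHi-≥ r≤L)
    stillFree (suc j) = refl

-- The arch windows.  Pendant b_{j+1} (j < k) may sit in gaps j + 1, …, n + j of the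
-- trunk of length n + k: after a_{j+1} = trunk action j, before c_{j+1} = n + j.
archWindows : ℕ → (k : ℕ) → Vector Window k
archWindows n k j = suc (toℕ j) , n + toℕ j

-- The same windows listed from b_k down to b_1; peeling b_k off first is what
-- makes the count recursive in k.
archWindows↓ : ℕ → (k : ℕ) → Vector Window k
archWindows↓ n zero    = λ ()
archWindows↓ n (suc k) = (suc k , n + k) ∷ archWindows↓ n k

archWindows↓-closed : ∀ n k j → archWindows↓ n k j ≡ (k ∸ toℕ j , n + k ∸ suc (toℕ j))
archWindows↓-closed n (suc k) zero    rewrite +-suc n k = refl
archWindows↓-closed n (suc k) (suc j) rewrite +-suc n k = archWindows↓-closed n k j

archWindows↓-opposite : ∀ n k j → archWindows↓ n k (Fin.opposite j) ≡ archWindows n k j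
archWindows↓-opposite n k j rewrite archWindows↓-closed n k (Fin.opposite j) | opposite-prop j =
  cong₂ _,_ (m∸[m∸n]≡n j<k) (begin
    n + k ∸ suc (k ∸ suc (toℕ j))  ≡⟨ cong (n + k ∸_) (+-∸-assoc 1 j<k) ⟨
    n + k ∸ (k ∸ toℕ j)            ≡⟨ +-∸-assoc n (m∸n≤m k (toℕ j)) ⟩
    n + (k ∸ (k ∸ toℕ j))          ≡⟨ cong (n +_) (m∸[m∸n]≡n (<⇒≤ j<k)) ⟩
    n + toℕ j                      ∎)
  where
  open ≡-Reasoning
  j<k : toℕ j < k
  j<k = toℕ<n j

archWindows↓-reverse : ∀ n k j → reverseWindow (n + k) (archWindows↓ n k j) ≡ archWindows n k j
archWindows↓-reverse n k j rewrite archWindows↓-closed n k j =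
  cong₂ _,_ (m∸[m∸n]≡n (≤-trans j<k (m≤n+m k n)))
            (trans (+-∸-assoc n (m∸n≤m k (toℕ j))) (cong (n +_) (m∸[m∸n]≡n (<⇒≤ j<k))))
  where
  j<k : toℕ j < k
  j<k = toℕ<n j

archWindows↓-valid : ∀ n k → Valid (n + k) (archWindows↓ n k)
archWindows↓-valid n k j rewrite archWindows↓-closed n k j =
  ≤-trans (m∸n≤m k (toℕ j)) (m≤n+m k n) , m∸n≤m (n + k) (suc (toℕ j))

archCount : ℕ → ℕ → ℕ
archCount n k = count k (archWindows↓ n k)

archCount-natural : ∀ n k → count k (archWindows n k) ≡ archCount n k
archCount-natural n k = trans (count-cong k (λ j → sym (archWindows↓-opposite n k j)))
                              (count-permute (n + k) (archWindows↓ n k) reverse (archWindows↓-valid n k))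

pinnedCount : ℕ → ℕ → ℕ → ℕ
pinnedCount n k p = count k (map (shiftWindow p) (archWindows↓ n k))

archCount-suc : ∀ n k → archCount n (suc k) ≡ sumFrom (suc k) n (pinnedCount n k)
archCount-suc n k = cong (λ g → sumFrom (suc k) g (pinnedCount n k)) (m+n∸n≡m n k)

archCount-free : ∀ n k → sumFrom 0 (suc (n + k)) (pinnedCount n k) ≡ suc (n + k + k) * archCount n k
archCount-free n k = count-freePendant k (n + k) (archWindows↓ n k) (archWindows↓-valid n k)

-- Pinning to a gap k ≤ p ≤ n lengthens the middle of the trunk: it gives the
-- (n + 1, k)-arch.
pinnedCount-middle : ∀ n k p → k ≤ p → p ≤ n → pinnedCount n k p ≡ archCount (suc n) k
pinnedCount-middle n k p k≤p p≤n = count-cong k (shifted k k≤p)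
  where
  shifted : ∀ k → k ≤ p → ∀ j → shiftWindow p (archWindows↓ n k j) ≡ archWindows↓ (suc n) k j
  shifted (suc k) k+1≤p zero    = cong₂ _,_ (shiftLo-≤ k+1≤p) (shiftHi-≥ (≤-trans p≤n (m≤m+n n k)))
  shifted (suc k) k+1≤p (suc j) = shifted k (≤-trans (n≤1+n k) k+1≤p) j

-- Pinning to gap p or to the mirror gap n + k ∸ p gives the same count: reverse
-- the trunk (count-reverse), which maps the arch to itself up to reordering.
pinnedCount-mirror : ∀ n k p → p ≤ n + k → pinnedCount n k p ≡ pinnedCount n k (n + k ∸ p)
pinnedCount-mirror n k p p≤L = begin
  pinnedCount n k p                                            ≡⟨ count-pinned k p W ⟨
  count (suc k) ((p , p) ∷ W)                                  ≡⟨ count-reverse (suc k) L ((p , p) ∷ W) valid ⟨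
  count (suc k) (reverseWindow L ∘ ((p , p) ∷ W))              ≡⟨ count-cong (suc k) mirrored ⟩
  count (suc k) (((L ∸ p , L ∸ p) ∷ W) ∘ (lift₀ reverse ⟨$⟩ʳ_)) ≡⟨ count-permute L ((L ∸ p , L ∸ p) ∷ W) (lift₀ reverse) valid′ ⟩
  count (suc k) ((L ∸ p , L ∸ p) ∷ W)                          ≡⟨ count-pinned k (L ∸ p) W ⟩
  pinnedCount n k (L ∸ p)                                      ∎
  where
  open ≡-Reasoning
  L : ℕ
  L = n + k
  W : Vector Window k
  W = archWindows↓ n k
  valid : Valid L ((p , p) ∷ W)
  valid zero    = p≤L , p≤L
  valid (suc j) = archWindows↓-valid n k j
  valid′ : Valid L ((L ∸ p , L ∸ p) ∷ W)
  valid′ zero    = m∸n≤m L p , m∸n≤m L p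
  valid′ (suc j) = archWindows↓-valid n k j
  mirrored : ∀ j → reverseWindow L (((p , p) ∷ W) j) ≡ ((L ∸ p , L ∸ p) ∷ W) (lift₀ reverse ⟨$⟩ʳ j)
  mirrored zero    = refl
  mirrored (suc j) = trans (archWindows↓-reverse n k j) (sym (archWindows↓-opposite n k j))

pinnedCount-sum-mirror : ∀ n k → sumFrom (suc k) n (pinnedCount n k) ≡ sumFrom 0 n (pinnedCount n k)
pinnedCount-sum-mirror n k = begin
  sumFrom (suc k) n G                          ≡⟨ sumFrom-cong (suc k) n (λ i i<n → pinnedCount-mirror n k (suc k + i) (bound i i<n)) ⟩
  sumFrom (suc k) n (λ p → G (n + k ∸ p))      ≡⟨ sumFrom-mirror n (suc k) (n + k) G (≤-reflexive end≡) ⟩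
  sumFrom (suc (n + k) ∸ (suc k + n)) n G      ≡⟨ cong (λ x → sumFrom (suc (n + k) ∸ x) n G) end≡ ⟩
  sumFrom (suc (n + k) ∸ suc (n + k)) n G      ≡⟨ cong (λ x → sumFrom x n G) (n∸n≡0 (n + k)) ⟩
  sumFrom 0 n G                                ∎
  where
  open ≡-Reasoning
  G : ℕ → ℕ
  G = pinnedCount n k
  end≡ : suc k + n ≡ suc (n + k)
  end≡ = cong suc (+-comm k n)
  bound : ∀ i → i < n → suc k + i ≤ n + k
  bound i i<n = s≤s⁻¹ (subst (suc (suc k + i) ≤_) end≡ (+-monoʳ-< (suc k) i<n))

-- With G = pinnedCount n k:
--   A(n, k+1) = G(k+1) + … + G(n+k) = G(0) + … + G(n-1)        (mirror),
--   G(0) + … + G(n+k) = (n + 2k + 1) A(n, k)                   (free pendant),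
--   G(p) = A(n+1, k) for k + 1 ≤ p ≤ n                         (middle).
arch-recurrence : ∀ n k → k ≤ n →
  2 * archCount n (suc k) + archCount (suc n) k ≡ (n + 2 * k + 1) * archCount n k + (n ∸ k) * archCount (suc n) k
arch-recurrence n k k≤n = begin
  2 * archCount n (suc k) + A′   ≡⟨ cong (λ a → 2 * a + A′) (archCount-suc n k) ⟩
  2 * X + A′                     ≡⟨ double-then X A′ ⟩
  X + (X + A′)                   ≡⟨ cong (X +_) upToN ⟩
  X + (S + d * A′)               ≡⟨ regroup X S (d * A′) ⟩
  (S + X) + d * A′               ≡⟨ cong (_+ d * A′) total ⟩
  (n + 2 * k + 1) * archCount n k + d * A′ ∎
  where
  open ≡-Reasoning
  G : ℕ → ℕ
  G = pinnedCount n k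
  A′ X S d : ℕ
  A′ = archCount (suc n) k
  X = sumFrom (suc k) n G
  S = sumFrom 0 (suc k) G
  d = n ∸ k
  double-then : ∀ x a → 2 * x + a ≡ x + (x + a)
  double-then = solve-∀
  regroup : ∀ x s y → x + (s + y) ≡ (s + x) + y
  regroup = solve-∀
  upToN : X + A′ ≡ S + d * A′
  upToN = begin
    X + A′                          ≡⟨ cong₂ _+_ (pinnedCount-sum-mirror n k) (sym (+-identityʳ A′)) ⟩
    sumFrom 0 n G + (A′ + 0)        ≡⟨ cong (λ a → sumFrom 0 n G + (a + 0)) (pinnedCount-middle n k n k≤n ≤-refl) ⟨
    sumFrom 0 n G + sumFrom n 1 G   ≡⟨ sumFrom-split 0 n 1 G ⟨
    sumFrom 0 (n + 1) G             ≡⟨ cong (λ g → sumFrom 0 g G) (trans (+-comm n 1) (cong suc (sym (m+[n∸m]≡n k≤n)))) ⟩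
    sumFrom 0 (suc k + d) G         ≡⟨ sumFrom-split 0 (suc k) d G ⟩
    S + sumFrom (suc k) d G         ≡⟨ cong (S +_) (sumFrom-const (suc k) d G A′ middle) ⟩
    S + d * A′                      ∎
    where
    middle : ∀ i → i < d → G (suc k + i) ≡ A′
    middle i i<d = pinnedCount-middle n k (suc k + i) (≤-trans (n≤1+n k) (m≤m+n (suc k) i))
                     (subst (suc k + i ≤_) (m+[n∸m]≡n k≤n) (+-monoʳ-< k i<d))
  total : S + X ≡ (n + 2 * k + 1) * archCount n k
  total = begin
    S + X                               ≡⟨ sumFrom-split 0 (suc k) n G ⟨
    sumFrom 0 (suc k + n) G             ≡⟨ cong (λ g → sumFrom 0 (suc g) G) (+-comm k n) ⟩
    sumFrom 0 (suc (n + k)) G           ≡⟨ archCount-free n k ⟩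
    suc (n + k + k) * archCount n k     ≡⟨ cong (_* archCount n k) (length n k) ⟩
    (n + 2 * k + 1) * archCount n k     ∎
    where
    length : ∀ n k → suc (n + k + k) ≡ n + 2 * k + 1
    length = solve-∀

arch≅pendant : ∀ n k → Inverse (RunSetoid (Arch n k)) (RunSetoid (Pendant (n + k) k (archWindows n k)))
arch≅pendant n k = relabel (Arch n k) (Pendant (n + k) k (archWindows n k)) e (cast e) (cast (sym e))
                     (cast-involutive e (sym e)) (cast-involutive (sym e) e) to from
  where
  e : n + 2 * k ≡ n + k + k
  e = trans (cong (λ z → n + (k + z)) (+-identityʳ k)) (sym (+-assoc n k k))
  to : ∀ u v → archEdge n k u v → TransClosure (PendantEdge (n + k) k (archWindows n k)) (cast e u) (cast e v)
  to u v (inj₁ (v≡ , v<L)) =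
    [ inj₁ (trans (toℕ-cast e v) (trans v≡ (cong suc (sym (toℕ-cast e u)))) , subst (_< n + k) (sym (toℕ-cast e v)) v<L) ]
  to u v (inj₂ (inj₁ (i , i<k , u≡ , v≡))) =
    [ inj₂ (inj₁ (fromℕ< i<k , trans (toℕ-cast e v) (trans v≡ (cong (n + k +_) (sym (toℕ-fromℕ< i<k)))) ,
                  cong suc (trans (toℕ-cast e u) (trans u≡ (sym (toℕ-fromℕ< i<k)))))) ]
  to u v (inj₂ (inj₂ (i , i<k , u≡ , v≡))) =
    [ inj₂ (inj₂ (fromℕ< i<k , trans (toℕ-cast e u) (trans u≡ (cong (n + k +_) (sym (toℕ-fromℕ< i<k)))) ,
                  trans (toℕ-cast e v) (trans v≡ (cong (n +_) (sym (toℕ-fromℕ< i<k)))) ,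
                  +-monoʳ-< n (toℕ<n (fromℕ< i<k)))) ]
  from : ∀ u v → PendantEdge (n + k) k (archWindows n k) u v → TransClosure (archEdge n k) (cast (sym e) u) (cast (sym e) v)
  from u v (inj₁ (v≡ , v<L)) =
    [ inj₁ (trans (toℕ-cast (sym e) v) (trans v≡ (cong suc (sym (toℕ-cast (sym e) u)))) ,
            subst (_< n + k) (sym (toℕ-cast (sym e) v)) v<L) ]
  from u v (inj₂ (inj₁ (j , v≡ , u≡))) =
    [ inj₂ (inj₁ (toℕ j , toℕ<n j , trans (toℕ-cast (sym e) u) (suc-injective u≡) , trans (toℕ-cast (sym e) v) v≡)) ]
  from u v (inj₂ (inj₂ (j , u≡ , v≡ , _))) =
    [ inj₂ (inj₂ (toℕ j , toℕ<n j , trans (toℕ-cast (sym e) u) u≡ , trans (toℕ-cast (sym e) v) v≡)) ]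

archWindows-valid : ∀ n k → Valid (n + k) (archWindows n k)
archWindows-valid n k j = ≤-trans (toℕ<n j) (m≤n+m k n) , <⇒≤ (+-monoʳ-< n (toℕ<n j))

σ-arch : ∀ n k → σ≡ (Arch n k) (archCount n k)
σ-arch n k = subst (σ≡ (Arch n k)) (archCount-natural n k)
                   (σ-along (arch≅pendant n k) (σ-pendant k (n + k) (archWindows n k) (archWindows-valid n k)))

open import Data.Integer using (ℤ; +_)

arch-recurrenceℤ : ∀ n k → k ≤ n →
  + 2 ℤ.* + archCount n (suc k) ≡ + (n + 2 * k + 1) ℤ.* + archCount n k ℤ.+ (+ n ℤ.- + suc k) ℤ.* + archCount (suc n) k
arch-recurrenceℤ n k k≤n = begin
  + 2 ℤ.* a                                   ≡⟨ cancel (+ 2 ℤ.* a) a′ ⟨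
  (+ 2 ℤ.* a ℤ.+ a′) ℤ.- a′                   ≡⟨ cong (ℤ._- a′) inℤ ⟩
  (+ b ℤ.* c ℤ.+ + (n ∸ k) ℤ.* a′) ℤ.- a′      ≡⟨ cong (λ z → (+ b ℤ.* c ℤ.+ z ℤ.* a′) ℤ.- a′) n∸k≡ ⟩
  (+ b ℤ.* c ℤ.+ (+ n ℤ.- + k) ℤ.* a′) ℤ.- a′  ≡⟨ shift (+ b ℤ.* c) (+ n) (+ k) a′ ⟩
  + b ℤ.* c ℤ.+ (+ n ℤ.- (+ 1 ℤ.+ + k)) ℤ.* a′ ∎
  where
  open ≡-Reasoning
  a a′ c : ℤ
  a = + archCount n (suc k)
  a′ = + archCount (suc n) k
  c = + archCount n k
  b : ℕ
  b = n + 2 * k + 1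
  cancel : ∀ x y → (x ℤ.+ y) ℤ.- y ≡ x
  cancel = ℤ-solve-∀
  shift : ∀ x n k y → (x ℤ.+ (n ℤ.- k) ℤ.* y) ℤ.- y ≡ x ℤ.+ (n ℤ.- (+ 1 ℤ.+ k)) ℤ.* y
  shift = ℤ-solve-∀
  n∸k≡ : + (n ∸ k) ≡ + n ℤ.- + k
  n∸k≡ = sym (trans (ℤ.m-n≡m⊖n n k) (ℤ.⊖-≥ k≤n))
  inℤ : + 2 ℤ.* a ℤ.+ a′ ≡ + b ℤ.* c ℤ.+ + (n ∸ k) ℤ.* a′
  inℤ = begin
    + 2 ℤ.* a ℤ.+ a′                        ≡⟨ cong (ℤ._+ a′) (ℤ.pos-* 2 (archCount n (suc k))) ⟨
    + (2 * archCount n (suc k)) ℤ.+ a′      ≡⟨ ℤ.pos-+ (2 * archCount n (suc k)) (archCount (suc n) k) ⟨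
    + (2 * archCount n (suc k) + archCount (suc n) k) ≡⟨ cong +_ (arch-recurrence n k k≤n) ⟩
    + (b * archCount n k + (n ∸ k) * archCount (suc n) k) ≡⟨ ℤ.pos-+ (b * archCount n k) ((n ∸ k) * archCount (suc n) k) ⟩
    + (b * archCount n k) ℤ.+ + ((n ∸ k) * archCount (suc n) k)
                                            ≡⟨ cong₂ ℤ._+_ (ℤ.pos-* b (archCount n k)) (ℤ.pos-* (n ∸ k) (archCount (suc n) k)) ⟩
    + b ℤ.* c ℤ.+ + (n ∸ k) ℤ.* a′          ∎

half-combination : ∀ (a x b y c : ℤ) → + 2 ℤ.* a ≡ x ℤ.* b ℤ.+ y ℤ.* c →
                   a / 1 ≡ (x / 2) ℚ.* (b / 1) ℚ.+ (y / 2) ℚ.* (c / 1)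
half-combination a x b y c 2a≡ =
  ℚ.toℚᵘ-injective (ℚᵘ.≃-trans (fraction a 0) (ℚᵘ.≃-trans unnormalised (ℚᵘ.≃-sym normalise)))
  where
  fraction : ∀ z d → ℚ.toℚᵘ (z / suc d) ℚᵘ.≃ ℚᵘ.mkℚᵘ z d
  fraction z d = ℚ.toℚᵘ-fromℚᵘ (ℚᵘ.mkℚᵘ z d)
  half : ∀ z w → ℚ.toℚᵘ ((z / 2) ℚ.* (w / 1)) ℚᵘ.≃ ℚᵘ.mkℚᵘ z 1 ℚᵘ.* ℚᵘ.mkℚᵘ w 0
  half z w = ℚᵘ.≃-trans (ℚ.toℚᵘ-homo-* (z / 2) (w / 1)) (ℚᵘ.*-cong (fraction z 1) (fraction w 0))
  normalise : ℚ.toℚᵘ ((x / 2) ℚ.* (b / 1) ℚ.+ (y / 2) ℚ.* (c / 1)) ℚᵘ.≃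
              (ℚᵘ.mkℚᵘ x 1 ℚᵘ.* ℚᵘ.mkℚᵘ b 0) ℚᵘ.+ (ℚᵘ.mkℚᵘ y 1 ℚᵘ.* ℚᵘ.mkℚᵘ c 0)
  normalise = ℚᵘ.≃-trans (ℚ.toℚᵘ-homo-+ ((x / 2) ℚ.* (b / 1)) ((y / 2) ℚ.* (c / 1))) (ℚᵘ.+-cong (half x b) (half y c))
  unnormalised : ℚᵘ.mkℚᵘ a 0 ℚᵘ.≃ (ℚᵘ.mkℚᵘ x 1 ℚᵘ.* ℚᵘ.mkℚᵘ b 0) ℚᵘ.+ (ℚᵘ.mkℚᵘ y 1 ℚᵘ.* ℚᵘ.mkℚᵘ c 0)
  unnormalised = ℚᵘ.*≡* (trans (by4 a) (trans (cong (ℤ._* + 2) 2a≡) (by2 x b y c)))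
    where
    by4 : ∀ a → a ℤ.* + 4 ≡ (+ 2 ℤ.* a) ℤ.* + 2
    by4 = ℤ-solve-∀
    by2 : ∀ x b y c → (x ℤ.* b ℤ.+ y ℤ.* c) ℤ.* + 2 ≡ ((x ℤ.* b) ℤ.* + 2 ℤ.+ (y ℤ.* c) ℤ.* + 2) ℤ.* + 1
    by2 = ℤ-solve-∀

archCount≡t : ∀ k n → k ≤ n + 1 → (+ archCount n k) / 1 ≡ t n k
archCount≡t zero    n _     = refl
archCount≡t (suc k) n k+1≤n+1 =
  trans (half-combination (+ archCount n (suc k)) (+ (n + 2 * k + 1)) (+ archCount n k)
                                (+ n ℤ.- + suc k) (+ archCount (suc n) k) (arch-recurrenceℤ n k k≤n))
        (cong₂ (λ u v → ((+ (n + 2 * k + 1)) / 2) ℚ.* u ℚ.+ ((+ n ℤ.- + suc k) / 2) ℚ.* v)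
               (archCount≡t k n (≤-trans k≤n (m≤m+n n 1)))
               (archCount≡t k (suc n) (≤-trans (≤-trans k≤n (n≤1+n n)) (m≤m+n (suc n) 1))))
  where
  k≤n : k ≤ n
  k≤n = s≤s⁻¹ (subst (suc k ≤_) (+-comm n 1) k+1≤n+1)

theorem1 : (n k : ℕ) → k ≤ n + 1 →
    ∃[ m ] (σ≡ (Arch n k) m × (+ m) / 1 ≡ t n k)
theorem1 n k k≤n+1 = archCount n k , σ-arch n k , archCount≡t k n k≤n+1
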